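{- Let $\Sigma$ be a finite CW complex of dimension $d$ and suppose $\Sigma$ has a cellular spanning forest $\Upsilon$ such that $\tilde H_{d-1}(\Upsilon;\mathbb{Z})$ is torsion-free. For $\sigma\in\Upsilon$ let $$\chi(\Upsilon,\sigma)=\sum_{\rho\in\operatorname{bond}(\Upsilon,\sigma)}\varepsilon^{\Upsilon\setminus\sigma}_{\sigma,\rho}\,\mathbf{t}_{d-1}(\Upsilon\setminus\sigma\cup\rho)\,\rho.$$ Then $\{\chi(\Upsilon,\sigma):\sigma\in\Upsilon\}$ is an integral basis of the cut lattice $\mathcal{C}(\Sigma)=\operatorname{im}_{\mathbb{Z}}\partial_d^*$.
   Context: $\Sigma$ has the convention of a unique $(-1)$-cell (reduced homology); $d$-cells are facets, oriented, identified with the standard basis of $C_d(\Sigma;\mathbb{Z})\cong\mathbb{Z}^n$; $\partial_d$ is the cellular boundary map and $\partial_d^*$ its transpose. Subcomplexes of dimension $d$ contain the full $(d-1)$-skeleton and are identified with their facet sets. A cellular spanning forest (CSF) is such a subcomplex whose facets index a basis of the column space of $\partial_d$ over $\mathbb{R}$. For a CSF $\Upsilon$ and $\sigma\in\Upsilon$, $\operatorname{bond}(\Upsilon,\sigma)=\{\sigma\}\cup\{\rho\notin\Upsilon:\Upsilon\setminus\sigma\cup\rho\text{ is a CSF}\}$. $\mathbf{t}_{d-1}(X)=|\operatorname{tor}(\tilde H_{d-1}(X;\mathbb{Z}))|$. For a set $A$ of facets and $\rho,\rho'$ with $A\cup\rho$, $A\cup\rho'$ CSFs, $\varepsilon^A_{\rho,\rho'}$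 is $+1$ or $-1$ according as $\partial\rho,\partial\rho'$ lie on the same or opposite sides of the hyperplane in $\operatorname{im}_{\mathbb{R}}\partial_d$ spanned by $\{\partial\tau:\tau\in A\}$. -}

module Defs where

open import Data.Nat using (ℕ; zero; suc)
open import Data.Integer as ℤ using (ℤ; +_; -[1+_])
open import Data.Rational as ℚ using (ℚ; 0ℚ)
open import Data.Fin using (Fin; zero; suc)
open import Data.Fin.Subset using (Subset; _∈_; _∉_; _∪_; _-_; ⁅_⁆)
open import Data.Product using (Σ; ∃; _×_; _,_)
open import Data.Sum using (_⊎_)
open import Relation.Binary.PropositionalEquality using (_≡_; _≢_)
open import Relation.Nullary using (¬_)
open import Data.Bool using (true; false)
import Data.Vec

sumℤ : ∀ {n} → (Fin n → ℤ) → ℤ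
sumℤ {zero}  f = + 0
sumℤ {suc n} f = f zero ℤ.+ sumℤ (λ i → f (suc i))

sumℚ : ∀ {n} → (Fin n → ℚ) → ℚ
sumℚ {zero}  f = 0ℚ
sumℚ {suc n} f = f zero ℚ.+ sumℚ (λ i → f (suc i))

toℚ : ℤ → ℚ
toℚ z = z ℚ./ 1

-- The data of Σ: the top part of its reduced cellular chain complex.
--   C_d = ℤ^n (facets), C_{d-1} = ℤ^m, C_{d-2} = ℤ^k,
--   bd  = ∂_d     (row i = (d-1)-cell, column j = facet),
--   bd' = ∂_{d-1} (row = (d-2)-cell, column = (d-1)-cell),
--   with ∂_{d-1} ∘ ∂_d = 0.

record CellComplex : Set where
  field
    d k m n : ℕ
    bd  : Fin m → Fin n → ℤ
    bd' : Fin k → Fin m → ℤ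
    bd∘bd≡0 : ∀ (l : Fin k) (j : Fin n) →
              sumℤ (λ i → bd' l i ℤ.* bd i j) ≡ + 0

module _ (Σc : CellComplex) where
  open CellComplex Σc

  -- a facet set = a d-dimensional subcomplex with full (d-1)-skeleton
  -- coefficient vectors supported on a facet set
  SupportedOnℚ : Subset n → (Fin n → ℚ) → Set
  SupportedOnℚ S c = ∀ j → j ∉ S → c j ≡ 0ℚ

  SupportedOnℤ : Subset n → (Fin n → ℤ) → Set
  SupportedOnℤ S c = ∀ j → j ∉ S → c j ≡ + 0

  bdℚ : (Fin n → ℚ) → Fin m → ℚ
  bdℚ c i = sumℚ (λ j → toℚ (bd i j) ℚ.* c j)

  bdℤ : (Fin n → ℤ) → Fin m → ℤ
  bdℤ c i = sumℤ (λ j → bd i j ℤ.* c j)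

  cobd : (Fin m → ℤ) → Fin n → ℤ
  cobd y j = sumℤ (λ i → bd i j ℤ.* y i)

  LinIndep : Subset n → Set
  LinIndep S = ∀ c → SupportedOnℚ S c → (∀ i → bdℚ c i ≡ 0ℚ) → ∀ j → c j ≡ 0ℚ

  SpansColSpace : Subset n → Set
  SpansColSpace S = ∀ c → ∃ λ c' → SupportedOnℚ S c' × (∀ i → bdℚ c' i ≡ bdℚ c i)

  IsCSF : Subset n → Set
  IsCSF S = LinIndep S × SpansColSpace S

  InBond : Subset n → Fin n → Fin n → Set
  InBond Υ σ ρ = ρ ≡ σ ⊎ (ρ ∉ Υ × IsCSF ((Υ - σ) ∪ ⁅ ρ ⁆))

  -- Reduced homology H̃_{d-1}(X;ℤ) = ker ∂_{d-1} / im_ℤ (∂_d restricted to X)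
  InCycles : (Fin m → ℤ) → Set
  InCycles z = ∀ l → sumℤ (λ i → bd' l i ℤ.* z i) ≡ + 0

  InBoundaries : Subset n → (Fin m → ℤ) → Set
  InBoundaries X z = ∃ λ c → SupportedOnℤ X c × (∀ i → bdℤ c i ≡ z i)

  IsTorsionCycle : Subset n → (Fin m → ℤ) → Set
  IsTorsionCycle X z = InCycles z ×
    (∃ λ (N : ℕ) → InBoundaries X (λ i → + (suc N) ℤ.* z i))

  HomologousIn : Subset n → (Fin m → ℤ) → (Fin m → ℤ) → Set
  HomologousIn X z z' = InBoundaries X (λ i → z i ℤ.- z' i)

  TorsionFree : Subset n → Set
  TorsionFree X = ∀ z → IsTorsionCycle X z → HomologousIn X z (λ _ → + 0)

  HasTorsionOrder : Subset n → ℕ → Set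
  HasTorsionOrder X t = ∃ λ (f : Fin t → Fin m → ℤ) →
      (∀ a → IsTorsionCycle X (f a))
    × (∀ a b → a ≢ b → ¬ HomologousIn X (f a) (f b))
    × (∀ z → IsTorsionCycle X z → ∃ λ a → HomologousIn X z (f a))

  -- ∂ρ, ∂ρ' lie on the same (resp. opposite) side of the hyperplane
  -- spanned by {∂τ : τ ∈ A} in im ∂_d: witnessed by a linear functional
  -- φ vanishing on that hyperplane
  pair : (Fin m → ℚ) → Fin n → ℚ
  pair φ j = sumℚ (λ i → φ i ℚ.* toℚ (bd i j))

  SameSide : Subset n → Fin n → Fin n → Set
  SameSide A ρ ρ' = ∃ λ φ → (∀ τ → τ ∈ A → pair φ τ ≡ 0ℚ)
                          × (0ℚ ℚ.< pair φ ρ) × (0ℚ ℚ.< pair φ ρ')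

  OppositeSide : Subset n → Fin n → Fin n → Set
  OppositeSide A ρ ρ' = ∃ λ φ → (∀ τ → τ ∈ A → pair φ τ ≡ 0ℚ)
                          × (0ℚ ℚ.< pair φ ρ) × (pair φ ρ' ℚ.< 0ℚ)

  IsSign : Subset n → Fin n → Fin n → ℤ → Set
  IsSign A ρ ρ' e = (e ≡ + 1 × SameSide A ρ ρ') ⊎ (e ≡ -[1+ 0 ] × OppositeSide A ρ ρ')

  IsCutLatticeBasis : Subset n → (Fin n → Fin n → ℤ) → Set
  IsCutLatticeBasis Υ v =
      (∀ σ → σ ∈ Υ → ∃ λ y → ∀ j → v σ j ≡ cobd y j)
    × (∀ a → SupportedOnℤ Υ a →
         (∀ j → sumℤ (λ σ → a σ ℤ.* v σ j) ≡ + 0) → ∀ σ → a σ ≡ + 0)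
    × (∀ y → ∃ λ a → SupportedOnℤ Υ a ×
         (∀ j → cobd y j ≡ sumℤ (λ σ → a σ ℤ.* v σ j)))

  chi : Subset n → (Fin n → Subset n) → (Fin n → Fin n → ℤ) → (Subset n → ℕ)
      → Fin n → Fin n → ℤ
  chi Υ B eps T σ ρ with Data.Vec.lookup (B σ) ρ
  ... | true  = eps σ ρ ℤ.* + T ((Υ - σ) ∪ ⁅ ρ ⁆)
  ... | false = + 0

-- Since Υ is a cellular spanning forest with H̃_{d-1}(Υ) torsion-free, the boundaries ∂τ (τ ∈ Υ) are
-- independent and span a saturated sublattice of ℤ^m. Splitting off one column at a time with Bézout
-- coefficients yields y_σ ∈ ℤ^m with ⟨y_σ, ∂τ⟩ = δ_στ on Υ. Then q_σρ = ⟨y_σ, ∂ρ⟩ is the σ-coordinate of ∂ρ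
-- in the basis ∂Υ, and the coboundaries ∂*y_σ = (q_σρ)_ρ form an integral basis of the cut lattice, so it
-- suffices to show χ(Υ,σ)_ρ = q_σρ. Put X = Υ∖σ∪ρ. If q_σρ ≠ 0 then σ and ρ can be exchanged, so ρ lies in
-- the bond; if q_σρ = 0 the relation ∂ρ = Σ q_τρ ∂τ is supported on X, so ρ does not. Shifting chains along
-- that relation shows that two cycles over Υ are homologous in X exactly when their σ-coordinates agree
-- modulo q_σρ, so tor H̃_{d-1}(X) is cyclic of order |q_σρ|, generated by ∂σ. Finally a functional vanishing
-- on ∂(Υ∖σ) takes the value q_σρ·φ(∂σ) at ∂ρ, so ε^{Υ∖σ}_{σ,ρ} is the sign of q_σρ.

module Submission where

open import Defs
open import Algebra.Bundles using (CommutativeRing)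
open import Data.Nat using (ℕ)
open import Data.Integer using (ℤ)
open import Data.Fin using (Fin; zero; suc; _≟_)
import Data.Fin.Properties as Fin
open import Data.Fin.Subset using (Subset; _∈_; _∉_)
open import Data.Fin.Subset.Properties using (_∈?_)
open import Data.Product using (_×_; proj₁; proj₂)
open import Function using (_∘_)
open import Relation.Binary.PropositionalEquality as ≡ using (_≡_; _≢_)
open import Relation.Nullary using (yes; no; contradiction)

module MatrixAlgebra {c ℓ} (R : CommutativeRing c ℓ) where

  open CommutativeRing R hiding (zero)
  open import Algebra.Properties.Ring ring using (-1*x≈-x; -‿distribʳ-*; -‿distribˡ-*)
  open import Algebra.Properties.Semiring.Sum semiring public
    using (sum; sum-cong-≋; ∑-distrib-+; ∑-comm; *-distribˡ-sum; *-distribʳ-sum)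
  open import Algebra.Properties.Semiring.Sum semiring using (sum-replicate-zero)
  open import Algebra.Properties.CommutativeSemigroup *-commutativeSemigroup using (x∙yz≈y∙xz)
  open import Relation.Binary.Reasoning.Setoid setoid

  sum-zero : ∀ {n} (f : Fin n → Carrier) → (∀ i → f i ≈ 0#) → sum f ≈ 0#
  sum-zero {n} f f≈0 = trans (sum-cong-≋ f≈0) (sum-replicate-zero n)

  sum-single : ∀ {n} (f : Fin n → Carrier) k → (∀ i → i ≢ k → f i ≈ 0#) → sum f ≈ f k
  sum-single f zero    f≈0 =
    trans (+-congˡ (sum-zero (f ∘ suc) (λ i → f≈0 (suc i) λ ()))) (+-identityʳ _)
  sum-single f (suc k) f≈0 =
    trans (+-cong (f≈0 zero λ ()) (sum-single (f ∘ suc) k (λ i i≢k → f≈0 (suc i) (i≢k ∘ Fin.suc-injective))))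
          (+-identityˡ _)

  sum-neg : ∀ {n} (f : Fin n → Carrier) → sum (λ i → - f i) ≈ - sum f
  sum-neg f = begin
    sum (λ i → - f i)         ≈⟨ sum-cong-≋ (λ i → sym (-1*x≈-x (f i))) ⟩
    sum (λ i → - 1# * f i)    ≈⟨ sym (*-distribˡ-sum (- 1#) f) ⟩
    - 1# * sum f              ≈⟨ -1*x≈-x (sum f) ⟩
    - sum f                   ∎

  -- δ and restrict are used only through their lemmas; kept abstract so that `with` on a membership
  -- test never has to see through them.
  abstract
    δ : ∀ {n} → Fin n → Fin n → Carrier
    δ i j with i ≟ j
    ... | yes _ = 1#
    ... | no  _ = 0#

    δ-diag : ∀ {n} (i : Fin n) → δ i i ≡ 1#
    δ-diag i with i ≟ i
    ... | yes _   = ≡.refl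
    ... | no  i≢i = contradiction ≡.refl i≢i

    δ-off : ∀ {n} {i j : Fin n} → i ≢ j → δ i j ≡ 0#
    δ-off {i = i} {j} i≢j with i ≟ j
    ... | yes i≡j = contradiction i≡j i≢j
    ... | no  _   = ≡.refl

  Supported : ∀ {n} → Subset n → (Fin n → Carrier) → Set ℓ
  Supported S c = ∀ j → j ∉ S → c j ≈ 0#

  δ-supported : ∀ {n} {S : Subset n} {σ} → σ ∈ S → Supported S (δ σ)
  δ-supported {S = S} σ∈S j j∉S = reflexive (δ-off λ σ≡j → j∉S (≡.subst (_∈ S) σ≡j σ∈S))

  abstract
    restrict : ∀ {n} → Subset n → (Fin n → Carrier) → Fin n → Carrier
    restrict S f j with j ∈? S
    ... | yes _ = f j
    ... | no  _ = 0#

    restrict-∈ : ∀ {n} {S : Subset n} f {j} → j ∈ S → restrict S f j ≡ f j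
    restrict-∈ {S = S} f {j} j∈S with j ∈? S
    ... | yes _   = ≡.refl
    ... | no  j∉S = contradiction j∈S j∉S

    restrict-∉ : ∀ {n} {S : Subset n} f {j} → j ∉ S → restrict S f j ≡ 0#
    restrict-∉ {S = S} f {j} j∉S with j ∈? S
    ... | yes j∈S = contradiction j∈S j∉S
    ... | no  _   = ≡.refl

  infixl 7 _*ᵛ_
  infixr 7 _ᵛ*_

  _*ᵛ_ : ∀ {m n} → (Fin m → Fin n → Carrier) → (Fin n → Carrier) → Fin m → Carrier
  (M *ᵛ c) i = sum λ j → M i j * c j

  _ᵛ*_ : ∀ {m n} → (Fin m → Carrier) → (Fin m → Fin n → Carrier) → Fin n → Carrier
  (y ᵛ* M) j = sum λ i → y i * M i j

  module _ {m n} (M : Fin m → Fin n → Carrier) where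

    *ᵛ-cong : ∀ {c d} → (∀ j → c j ≈ d j) → ∀ i → (M *ᵛ c) i ≈ (M *ᵛ d) i
    *ᵛ-cong c≈d i = sum-cong-≋ λ j → *-congˡ (c≈d j)

    *ᵛ-+ : ∀ c d i → (M *ᵛ (λ j → c j + d j)) i ≈ (M *ᵛ c) i + (M *ᵛ d) i
    *ᵛ-+ c d i = trans (sum-cong-≋ λ j → distribˡ (M i j) (c j) (d j)) (∑-distrib-+ (λ j → M i j * c j) (λ j → M i j * d j))

    *ᵛ-scale : ∀ a c i → (M *ᵛ (λ j → a * c j)) i ≈ a * (M *ᵛ c) i
    *ᵛ-scale a c i = begin
      sum (λ j → M i j * (a * c j))  ≈⟨ sum-cong-≋ (λ j → x∙yz≈y∙xz (M i j) a (c j)) ⟩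
      sum (λ j → a * (M i j * c j))  ≈⟨ sym (*-distribˡ-sum a (λ j → M i j * c j)) ⟩
      a * (M *ᵛ c) i                 ∎

    *ᵛ-neg : ∀ c i → (M *ᵛ (λ j → - c j)) i ≈ - (M *ᵛ c) i
    *ᵛ-neg c i = trans (sum-cong-≋ λ j → sym (-‿distribʳ-* (M i j) (c j))) (sum-neg (λ j → M i j * c j))

    *ᵛ-add-kernel : ∀ {v} → (∀ i → (M *ᵛ v) i ≈ 0#) → ∀ c t i → (M *ᵛ (λ j → c j + t * v j)) i ≈ (M *ᵛ c) i
    *ᵛ-add-kernel {v} Mv≈0 c t i = begin
      (M *ᵛ (λ j → c j + t * v j)) i   ≈⟨ *ᵛ-+ c (λ j → t * v j) i ⟩
      (M *ᵛ c) i + (M *ᵛ (λ j → t * v j)) i ≈⟨ +-congˡ (*ᵛ-scale t v i) ⟩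
      (M *ᵛ c) i + t * (M *ᵛ v) i      ≈⟨ +-congˡ (trans (*-congˡ (Mv≈0 i)) (zeroʳ t)) ⟩
      (M *ᵛ c) i + 0#                  ≈⟨ +-identityʳ ((M *ᵛ c) i) ⟩
      (M *ᵛ c) i                       ∎

    *ᵛ-δ : ∀ k i → (M *ᵛ δ k) i ≈ M i k
    *ᵛ-δ k i = begin
      (M *ᵛ δ k) i  ≈⟨ sum-single (λ j → M i j * δ k j) k (λ j j≢k → trans (*-congˡ (reflexive (δ-off (j≢k ∘ ≡.sym)))) (zeroʳ _)) ⟩
      M i k * δ k k ≈⟨ *-congˡ (reflexive (δ-diag k)) ⟩
      M i k * 1#    ≈⟨ *-identityʳ _ ⟩
      M i k         ∎

    ᵛ*-*ᵛ : ∀ y c → sum (λ i → y i * (M *ᵛ c) i) ≈ sum (λ j → (y ᵛ* M) j * c j)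
    ᵛ*-*ᵛ y c = begin
      sum (λ i → y i * sum (λ j → M i j * c j))
        ≈⟨ sum-cong-≋ (λ i → trans (*-distribˡ-sum (y i) (λ j → M i j * c j)) (sum-cong-≋ λ j → sym (*-assoc (y i) (M i j) (c j)))) ⟩
      sum (λ i → sum (λ j → y i * M i j * c j))
        ≈⟨ ∑-comm (λ i j → y i * M i j * c j) ⟩
      sum (λ j → sum (λ i → y i * M i j * c j))
        ≈⟨ sum-cong-≋ (λ j → sym (*-distribʳ-sum (c j) (λ i → y i * M i j))) ⟩
      sum (λ j → (y ᵛ* M) j * c j) ∎

    ᵛ*-+ : ∀ y z j → ((λ i → y i + z i) ᵛ* M) j ≈ (y ᵛ* M) j + (z ᵛ* M) j
    ᵛ*-+ y z j = trans (sum-cong-≋ λ i → distribʳ (M i j) (y i) (z i)) (∑-distrib-+ (λ i → y i * M i j) (λ i → z i * M i j))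

    ᵛ*-scale : ∀ a y j → ((λ i → a * y i) ᵛ* M) j ≈ a * (y ᵛ* M) j
    ᵛ*-scale a y j = trans (sum-cong-≋ λ i → *-assoc a (y i) (M i j)) (sym (*-distribˡ-sum a (λ i → y i * M i j)))

    ᵛ*-neg : ∀ y j → ((λ i → - y i) ᵛ* M) j ≈ - (y ᵛ* M) j
    ᵛ*-neg y j = trans (sum-cong-≋ λ i → sym (-‿distribˡ-* (y i) (M i j))) (sum-neg (λ i → y i * M i j))

    ᵛ*-sum : ∀ {k} (a : Fin k → Carrier) (ys : Fin k → Fin m → Carrier) j →
             ((λ i → sum λ b → a b * ys b i) ᵛ* M) j ≈ sum (λ b → a b * (ys b ᵛ* M) j)
    ᵛ*-sum a ys j = begin
      sum (λ i → sum (λ b → a b * ys b i) * M i j)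
        ≈⟨ sum-cong-≋ (λ i → trans (*-distribʳ-sum (M i j) (λ b → a b * ys b i)) (sum-cong-≋ λ b → *-assoc (a b) (ys b i) (M i j))) ⟩
      sum (λ i → sum (λ b → a b * (ys b i * M i j)))
        ≈⟨ ∑-comm (λ i b → a b * (ys b i * M i j)) ⟩
      sum (λ b → sum (λ i → a b * (ys b i * M i j)))
        ≈⟨ sum-cong-≋ (λ b → sym (*-distribˡ-sum (a b) (λ i → ys b i * M i j))) ⟩
      sum (λ b → a b * (ys b ᵛ* M) j) ∎

    dual-coordinate : ∀ {S σ} y c → σ ∈ S → (∀ τ → τ ∈ S → (y ᵛ* M) τ ≈ δ σ τ) → Supported S c →
                      sum (λ i → y i * (M *ᵛ c) i) ≈ c σ
    dual-coordinate {S} {σ} y c σ∈S yM≈δ c∈S = begin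
      sum (λ i → y i * (M *ᵛ c) i)   ≈⟨ ᵛ*-*ᵛ y c ⟩
      sum (λ j → (y ᵛ* M) j * c j)   ≈⟨ sum-single (λ j → (y ᵛ* M) j * c j) σ off-σ ⟩
      (y ᵛ* M) σ * c σ               ≈⟨ *-congʳ (trans (yM≈δ σ σ∈S) (reflexive (δ-diag σ))) ⟩
      1# * c σ                       ≈⟨ *-identityˡ (c σ) ⟩
      c σ                            ∎
      where
      off-σ : ∀ j → j ≢ σ → (y ᵛ* M) j * c j ≈ 0#
      off-σ j j≢σ with j ∈? S
      ... | yes j∈S = trans (*-congʳ (trans (yM≈δ j j∈S) (reflexive (δ-off (j≢σ ∘ ≡.sym))))) (zeroˡ (c j))
      ... | no  j∉S = trans (*-congˡ (c∈S j j∉S)) (zeroʳ _)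

module IntegralLattices where

  open import Data.Nat as ℕ using (ℕ; zero; suc)
  import Data.Nat.Properties as ℕ
  open import Data.Nat.GCD using (module Bézout; GCD)
  open import Data.Integer as ℤ using (ℤ; +_; -[1+_]; 0ℤ; 1ℤ; -1ℤ; _+_; _*_; -_; _-_)
  import Data.Integer.Properties as ℤ
  open import Data.Integer.Divisibility.Signed using (_∣_; divides; quotient; ∣ᵤ⇒∣; ∣-trans; ∣m∣∣m)
  open import Data.Integer.Tactic.RingSolver using (solve-∀)
  open import Data.Fin.Subset using (_─_; ⁅_⁆; outside) renaming (∣_∣ to size)
  open import Data.Fin.Subset.Properties using (nonempty?; x∈p∧x≢y⇒x∈p-y; x∈p⇒∣p-x∣<∣p∣; x∈⁅x⁆; p─q⊆p)
  open import Data.Vec.Base using (_∷_; here; there)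
  open import Data.Product using (∃; ∃₂; _,_; uncurry)
  open import Relation.Binary.PropositionalEquality
  open import Relation.Nullary using (Dec)
  open import Algebra.Properties.CommutativeSemigroup ℤ.*-commutativeSemigroup using (x∙yz≈y∙xz)

  open MatrixAlgebra ℤ.+-*-commutativeRing

  sign-multiplier : ∀ a → ∃ λ s → s * a ≡ + ℤ.∣ a ∣
  sign-multiplier (+ k)    = 1ℤ , ℤ.*-identityˡ (+ k)
  sign-multiplier -[1+ k ] = -1ℤ , ℤ.-1*i≡-i -[1+ k ]

  private
    cast-identity : ∀ d p₁ p₂ q₁ q₂ → d ℕ.+ p₁ ℕ.* p₂ ≡ q₁ ℕ.* q₂ → + d + + p₁ * + p₂ ≡ + q₁ * + q₂
    cast-identity d p₁ p₂ q₁ q₂ eq = begin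
      + d + + p₁ * + p₂     ≡⟨ cong (λ t → + d + t) (ℤ.pos-* p₁ p₂) ⟨
      + d + + (p₁ ℕ.* p₂)   ≡⟨ ℤ.pos-+ d (p₁ ℕ.* p₂) ⟨
      + (d ℕ.+ p₁ ℕ.* p₂)   ≡⟨ cong +_ eq ⟩
      + (q₁ ℕ.* q₂)         ≡⟨ ℤ.pos-* q₁ q₂ ⟩
      + q₁ * + q₂           ∎
      where open ≡-Reasoning

    subtract-summand : ∀ d p q → d + p ≡ q → q - p ≡ d
    subtract-summand d p q eq = trans (cong (_- p) (sym eq)) (cancel d p)
      where
      cancel : ∀ d p → d + p - p ≡ d
      cancel = solve-∀

  bézout : ∀ a g → ∃₂ λ x y → ∃ λ d → x * a + y * + g ≡ + d × (+ d) ∣ a × (+ d) ∣ (+ g)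
  bézout a g with Bézout.lemma ℤ.∣ a ∣ g | sign-multiplier a
  ... | Bézout.result d (GCD.is (d∣a , d∣g) _) identity | s , sa≡∣a∣ =
    let x , y , eq = coefficients identity in x , y , d , eq , ∣-trans (∣ᵤ⇒∣ d∣a) ∣m∣∣m , ∣ᵤ⇒∣ d∣g
    where
    coefficients : Bézout.Identity d ℤ.∣ a ∣ g → ∃₂ λ x y → x * a + y * + g ≡ + d
    coefficients (Bézout.+- x y eq) = + x * s , - + y , (begin
      + x * s * a + - + y * + g   ≡⟨ rearrange (+ x) s a (+ y) (+ g) ⟩
      + x * (s * a) - + y * + g   ≡⟨ cong (λ t → + x * t - + y * + g) sa≡∣a∣ ⟩
      + x * + ℤ.∣ a ∣ - + y * + g   ≡⟨ subtract-summand (+ d) (+ y * + g) (+ x * + ℤ.∣ a ∣) (cast-identity d y g x ℤ.∣ a ∣ eq) ⟩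
      + d                         ∎)
      where
      open ≡-Reasoning
      rearrange : ∀ x s a y g → x * s * a + - y * g ≡ x * (s * a) - y * g
      rearrange = solve-∀
    coefficients (Bézout.-+ x y eq) = - (+ x * s) , + y , (begin
      - (+ x * s) * a + + y * + g  ≡⟨ rearrange (+ x) s a (+ y) (+ g) ⟩
      + y * + g - + x * (s * a)    ≡⟨ cong (λ t → + y * + g - + x * t) sa≡∣a∣ ⟩
      + y * + g - + x * + ℤ.∣ a ∣    ≡⟨ subtract-summand (+ d) (+ x * + ℤ.∣ a ∣) (+ y * + g) (cast-identity d x ℤ.∣ a ∣ y g eq) ⟩
      + d                          ∎)
      where
      open ≡-Reasoning
      rearrange : ∀ x s a y g → - (x * s) * a + y * g ≡ y * g - x * (s * a)
      rearrange = solve-∀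

  gcd-combination : ∀ {m} (v : Fin m → ℤ) →
                    ∃₂ λ (u : Fin m → ℤ) g → sum (λ i → u i * v i) ≡ + g × (∀ i → (+ g) ∣ v i)
  gcd-combination {zero}  v = (λ ()) , 0 , refl , λ ()
  gcd-combination {suc m} v with gcd-combination (v ∘ suc)
  ... | u , g , u·v≡g , g∣v with bézout (v zero) g
  ... | x , y , d , eq , d∣v₀ , d∣g = u′ , d , combination , divisor
    where
    u′ : Fin (suc m) → ℤ
    u′ zero    = x
    u′ (suc i) = y * u i
    combination : sum (λ i → u′ i * v i) ≡ + d
    combination = begin
      x * v zero + sum (λ i → y * u i * v (suc i))  ≡⟨ cong (λ t → x * v zero + t) (sum-cong-≋ λ i → ℤ.*-assoc y (u i) (v (suc i))) ⟩
      x * v zero + sum (λ i → y * (u i * v (suc i))) ≡⟨ cong (λ t → x * v zero + t) (*-distribˡ-sum y (λ i → u i * v (suc i))) ⟨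
      x * v zero + y * sum (λ i → u i * v (suc i))  ≡⟨ cong (λ t → x * v zero + y * t) u·v≡g ⟩
      x * v zero + y * + g                          ≡⟨ eq ⟩
      + d                                           ∎
      where open ≡-Reasoning
    divisor : ∀ i → (+ d) ∣ v i
    divisor zero    = d∣v₀
    divisor (suc i) = ∣-trans d∣g (g∣v i)

  x∈p─q⇒x∉q : ∀ {n} (p q : Subset n) {x} → x ∈ p ─ q → x ∉ q
  x∈p─q⇒x∉q (_ ∷ p) (outside ∷ q) here      ()
  x∈p─q⇒x∉q (_ ∷ p) (_       ∷ q) (there x∈) (there x∈q) = x∈p─q⇒x∉q p q x∈ x∈q

  x∉p-x : ∀ {n} (p : Subset n) x → x ∉ p ─ ⁅ x ⁆
  x∉p-x p x x∈ = x∈p─q⇒x∉q p ⁅ x ⁆ x∈ (x∈⁅x⁆ x)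

  module _ {m n : ℕ} where

    Independent : (Fin m → Fin n → ℤ) → Subset n → Set
    Independent M S = ∀ c → Supported S c → (∀ i → (M *ᵛ c) i ≡ 0ℤ) → ∀ j → c j ≡ 0ℤ

    InSpan : (Fin m → Fin n → ℤ) → Subset n → (Fin m → ℤ) → Set
    InSpan M S z = ∃ λ c → Supported S c × (∀ i → (M *ᵛ c) i ≡ z i)

    Saturated : (Fin m → Fin n → ℤ) → Subset n → Set
    Saturated M S = ∀ z N → InSpan M S (λ i → + suc N * z i) → InSpan M S z

    InSpan-cong : ∀ {M S z z′} → (∀ i → z i ≡ z′ i) → InSpan M S z → InSpan M S z′
    InSpan-cong z≗z′ (c , c∈S , Mc≡z) = c , c∈S , λ i → trans (Mc≡z i) (z≗z′ i)

    InSpan-sub : ∀ {M S z z′} → InSpan M S z → InSpan M S z′ → InSpan M S (λ i → z i - z′ i)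
    InSpan-sub {M} (c , c∈S , Mc≡z) (c′ , c′∈S , Mc′≡z′) =
      (λ j → c j - c′ j) ,
      (λ j j∉S → cong₂ _-_ (c∈S j j∉S) (c′∈S j j∉S)) ,
      λ i → trans (*ᵛ-+ M c (λ j → - c′ j) i) (cong₂ _+_ (Mc≡z i) (trans (*ᵛ-neg M c′ i) (cong -_ (Mc′≡z′ i))))

    IsDualBasis : (Fin m → Fin n → ℤ) → Subset n → (Fin n → Fin m → ℤ) → Set
    IsDualBasis M S y = ∀ σ τ → σ ∈ S → τ ∈ S → (y σ ᵛ* M) τ ≡ δ σ τ

    private
      unit-multiple : ∀ N c → + suc N * c ≡ 1ℤ → N ≡ 0
      unit-multiple N c eq =
        cong ℕ.pred (ℕ.m*n≡1⇒m≡1 (suc N) ℤ.∣ c ∣ (trans (sym (ℤ.abs-* (+ suc N) c)) (cong ℤ.∣_∣ eq)))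

    -- The gcd g of column σ divides it, so by saturation column/g lies in the span; independence then
    -- forces g = 1, and the Bézout coefficients are the functional.
    unimodular-functional : ∀ {M S σ} → Independent M S → Saturated M S → σ ∈ S →
                            ∃ λ u → (u ᵛ* M) σ ≡ 1ℤ
    unimodular-functional {M} {S} {σ} ind sat σ∈S with gcd-combination (λ i → M i σ)
    ... | u , zero , _ , 0∣col = contradiction (ind (δ σ) (δ-supported σ∈S) column≡0 σ) 1≢0
      where
      column≡0 : ∀ i → (M *ᵛ δ σ) i ≡ 0ℤ
      column≡0 i with 0∣col i
      ... | divides q eq = trans (*ᵛ-δ M σ i) (trans eq (ℤ.*-zeroʳ q))
      1≢0 : δ σ σ ≢ 0ℤ
      1≢0 eq with trans (sym (δ-diag σ)) eq
      ... | ()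
    ... | u , suc N , u·col≡g , g∣col = u , trans u·col≡g (cong (λ k → + suc k) N≡0)
      where
      z : Fin m → ℤ
      z i = quotient (g∣col i)
      column≡ : ∀ i → (M *ᵛ δ σ) i ≡ + suc N * z i
      column≡ i with g∣col i
      ... | divides q eq = trans (*ᵛ-δ M σ i) (trans eq (ℤ.*-comm q (+ suc N)))
      z-in-span : InSpan M S z
      z-in-span = sat z N (δ σ , δ-supported σ∈S , column≡)
      c = proj₁ z-in-span
      c′ : Fin n → ℤ
      c′ j = + suc N * c j - δ σ j
      c′-supported : Supported S c′
      c′-supported j j∉S rewrite proj₁ (proj₂ z-in-span) j j∉S | δ-supported σ∈S j j∉S
        = cong (_+ 0ℤ) (ℤ.*-zeroʳ (+ suc N))
      Mc′≡0 : ∀ i → (M *ᵛ c′) i ≡ 0ℤ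
      Mc′≡0 i = begin
        (M *ᵛ c′) i                                     ≡⟨ *ᵛ-+ M (λ j → + suc N * c j) (λ j → - δ σ j) i ⟩
        (M *ᵛ (λ j → + suc N * c j)) i + (M *ᵛ (λ j → - δ σ j)) i
                                                        ≡⟨ cong₂ _+_ (*ᵛ-scale M (+ suc N) c i) (*ᵛ-neg M (δ σ) i) ⟩
        + suc N * (M *ᵛ c) i - (M *ᵛ δ σ) i             ≡⟨ cong₂ (λ a b → + suc N * a - b) (proj₂ (proj₂ z-in-span) i) (column≡ i) ⟩
        + suc N * z i - + suc N * z i                   ≡⟨ ℤ.+-inverseʳ (+ suc N * z i) ⟩
        0ℤ                                              ∎
        where open ≡-Reasoning
      N≡0 : N ≡ 0
      N≡0 = unit-multiple N (c σ) (begin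
        + suc N * c σ               ≡⟨ ℤ.i-j≡0⇒i≡j _ _ (ind c′ c′-supported Mc′≡0 σ) ⟩
        δ σ σ                       ≡⟨ δ-diag σ ⟩
        1ℤ                          ∎)
        where open ≡-Reasoning

  -- As u·M_σ = 1, x ↦ x − (u·x) M_σ projects onto ker u along M_σ; M′ is M followed by this projection.
  module Projection {m n} (M : Fin m → Fin n → ℤ) (σ : Fin n)
                    (u : Fin m → ℤ) (uMσ≡1 : (u ᵛ* M) σ ≡ 1ℤ) where

    w : Fin n → ℤ
    w = u ᵛ* M

    M′ : Fin m → Fin n → ℤ
    M′ i j = M i j - w j * M i σ

    project : (Fin n → ℤ) → Fin n → ℤ
    project c j = c j - sum (λ k → w k * c k) * δ σ j

    *ᵛ-M′ : ∀ c i → (M′ *ᵛ c) i ≡ (M *ᵛ project c) i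
    *ᵛ-M′ c i = begin
      sum (λ j → (M i j - w j * M i σ) * c j)          ≡⟨ sum-cong-≋ (λ j → expand (M i j) (w j) (M i σ) (c j)) ⟩
      sum (λ j → M i j * c j + - (w j * c j * M i σ))   ≡⟨ ∑-distrib-+ (λ j → M i j * c j) (λ j → - (w j * c j * M i σ)) ⟩
      (M *ᵛ c) i + sum (λ j → - (w j * c j * M i σ))    ≡⟨ cong (_+_ ((M *ᵛ c) i)) (sum-neg (λ j → w j * c j * M i σ)) ⟩
      (M *ᵛ c) i - sum (λ j → w j * c j * M i σ)        ≡⟨ cong (λ t → (M *ᵛ c) i - t) (*-distribʳ-sum (M i σ) (λ j → w j * c j)) ⟨
      (M *ᵛ c) i - wc * M i σ                           ≡⟨ cong (λ t → (M *ᵛ c) i - wc * t) (*ᵛ-δ M σ i) ⟨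
      (M *ᵛ c) i - wc * (M *ᵛ δ σ) i                    ≡⟨ cong (_+_ ((M *ᵛ c) i)) (cong -_ (*ᵛ-scale M wc (δ σ) i)) ⟨
      (M *ᵛ c) i - (M *ᵛ (λ j → wc * δ σ j)) i          ≡⟨ cong (_+_ ((M *ᵛ c) i)) (*ᵛ-neg M (λ j → wc * δ σ j) i) ⟨
      (M *ᵛ c) i + (M *ᵛ (λ j → - (wc * δ σ j))) i      ≡⟨ *ᵛ-+ M c (λ j → - (wc * δ σ j)) i ⟨
      (M *ᵛ project c) i                                ∎
      where
      open ≡-Reasoning
      wc = sum (λ k → w k * c k)
      expand : ∀ a b e c → (a - b * e) * c ≡ a * c + - (b * c * e)
      expand = solve-∀

    ᵛ*-M′ : ∀ y j → (y ᵛ* M′) j ≡ (y ᵛ* M) j - w j * (y ᵛ* M) σ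
    ᵛ*-M′ y j = begin
      sum (λ i → y i * (M i j - w j * M i σ))            ≡⟨ sum-cong-≋ (λ i → expand (y i) (M i j) (w j) (M i σ)) ⟩
      sum (λ i → y i * M i j + - (w j * (y i * M i σ)))   ≡⟨ ∑-distrib-+ (λ i → y i * M i j) (λ i → - (w j * (y i * M i σ))) ⟩
      (y ᵛ* M) j + sum (λ i → - (w j * (y i * M i σ)))    ≡⟨ cong (_+_ ((y ᵛ* M) j)) (sum-neg (λ i → w j * (y i * M i σ))) ⟩
      (y ᵛ* M) j - sum (λ i → w j * (y i * M i σ))        ≡⟨ cong (λ t → (y ᵛ* M) j - t) (*-distribˡ-sum (w j) (λ i → y i * M i σ)) ⟨
      (y ᵛ* M) j - w j * (y ᵛ* M) σ                       ∎
      where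
      open ≡-Reasoning
      expand : ∀ y a b e → y * (a - b * e) ≡ y * a + - (b * (y * e))
      expand = solve-∀

    private
      minus-self : ∀ a → a - 1ℤ * a ≡ 0ℤ
      minus-self = solve-∀

    M′-column-σ : ∀ i → M′ i σ ≡ 0ℤ
    M′-column-σ i = trans (cong (λ t → M i σ - t * M i σ) uMσ≡1) (minus-self (M i σ))

    ᵛ*-M′-σ : ∀ y → (y ᵛ* M′) σ ≡ 0ℤ
    ᵛ*-M′-σ y = trans (ᵛ*-M′ y σ) (trans (cong (λ t → (y ᵛ* M) σ - t * (y ᵛ* M) σ) uMσ≡1) (minus-self ((y ᵛ* M) σ)))

    u-annihilates-M′ : ∀ j → (u ᵛ* M′) j ≡ 0ℤ
    u-annihilates-M′ j = begin
      (u ᵛ* M′) j       ≡⟨ ᵛ*-M′ u j ⟩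
      w j - w j * w σ   ≡⟨ cong (λ t → w j - w j * t) uMσ≡1 ⟩
      w j - w j * 1ℤ    ≡⟨ cong (λ t → w j - t) (ℤ.*-comm (w j) 1ℤ) ⟩
      w j - 1ℤ * w j    ≡⟨ minus-self (w j) ⟩
      0ℤ                ∎
      where open ≡-Reasoning

    u-annihilates-span : ∀ {S} (z : Fin m → ℤ) N → InSpan M′ S (λ i → + suc N * z i) → sum (λ i → u i * z i) ≡ 0ℤ
    u-annihilates-span z N (c , _ , M′c≡Nz) =
      ℤ.*-cancelˡ-≡ (+ suc N) (sum λ i → u i * z i) 0ℤ (trans N·uz≡0 (sym (ℤ.*-zeroʳ (+ suc N))))
      where
      open ≡-Reasoning
      N·uz≡0 : + suc N * sum (λ i → u i * z i) ≡ 0ℤ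
      N·uz≡0 = begin
        + suc N * sum (λ i → u i * z i)     ≡⟨ *-distribˡ-sum (+ suc N) (λ i → u i * z i) ⟩
        sum (λ i → + suc N * (u i * z i))   ≡⟨ sum-cong-≋ (λ i → trans (x∙yz≈y∙xz (+ suc N) (u i) (z i)) (cong (u i *_) (sym (M′c≡Nz i)))) ⟩
        sum (λ i → u i * (M′ *ᵛ c) i)       ≡⟨ ᵛ*-*ᵛ M′ u c ⟩
        sum (λ j → (u ᵛ* M′) j * c j)       ≡⟨ sum-zero (λ j → (u ᵛ* M′) j * c j) (λ j → cong (_* c j) (u-annihilates-M′ j)) ⟩
        0ℤ                                  ∎

    module _ {S : Subset n} (σ∈S : σ ∈ S) where

      private
        S′ = S ─ ⁅ σ ⁆

        ∉S′⇒∉S : ∀ {j} → j ≢ σ → j ∉ S′ → j ∉ S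
        ∉S′⇒∉S j≢σ j∉S′ j∈S = j∉S′ (x∈p∧x≢y⇒x∈p-y j∈S j≢σ)

      project-supported : ∀ {c} → Supported S′ c → Supported S (project c)
      project-supported {c} c∈S′ j j∉S = begin
        c j - wc * δ σ j   ≡⟨ cong₂ (λ a b → a - wc * b) (c∈S′ j (j∉S ∘ p─q⊆p S ⁅ σ ⁆)) (δ-supported σ∈S j j∉S) ⟩
        0ℤ - wc * 0ℤ       ≡⟨ cong (λ t → 0ℤ - t) (ℤ.*-zeroʳ wc) ⟩
        0ℤ                 ∎
        where
        open ≡-Reasoning
        wc = sum λ k → w k * c k

      project-off-σ : ∀ c {j} → j ≢ σ → project c j ≡ c j
      project-off-σ c {j} j≢σ = begin
        c j - wc * δ σ j   ≡⟨ cong (λ t → c j - wc * t) (δ-off (j≢σ ∘ sym)) ⟩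
        c j - wc * 0ℤ      ≡⟨ cong (λ t → c j - t) (ℤ.*-zeroʳ wc) ⟩
        c j - 0ℤ           ≡⟨ ℤ.+-identityʳ (c j) ⟩
        c j                ∎
        where
        open ≡-Reasoning
        wc = sum λ k → w k * c k

      independent : Independent M S → Independent M′ S′
      independent ind c c∈S′ M′c≡0 j with j ≟ σ
      ... | yes refl = c∈S′ σ (x∉p-x S σ)
      ... | no  j≢σ  = trans (sym (project-off-σ c j≢σ))
                             (ind (project c) (project-supported c∈S′) (λ i → trans (sym (*ᵛ-M′ c i)) (M′c≡0 i)) j)

      private
        descend : ∀ {z} → sum (λ i → u i * z i) ≡ 0ℤ → InSpan M S z → InSpan M′ S′ z
        descend {z} uz≡0 (b , b∈S , Mb≡z) =
          restrict S′ b , (λ j → restrict-∉ b) , λ i → trans (M′-restrict i) (M′b≡z i)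
          where
          wb≡0 : sum (λ k → w k * b k) ≡ 0ℤ
          wb≡0 = trans (sym (ᵛ*-*ᵛ M u b)) (trans (sum-cong-≋ λ i → cong (u i *_) (Mb≡z i)) uz≡0)

          M′b≡z : ∀ i → (M′ *ᵛ b) i ≡ z i
          M′b≡z i = begin
            (M′ *ᵛ b) i                ≡⟨ *ᵛ-M′ b i ⟩
            (M *ᵛ project b) i         ≡⟨ *ᵛ-cong M (λ j → cong (λ t → b j - t * δ σ j) wb≡0) i ⟩
            (M *ᵛ (λ j → b j + 0ℤ)) i  ≡⟨ *ᵛ-cong M (λ j → ℤ.+-identityʳ (b j)) i ⟩
            (M *ᵛ b) i                 ≡⟨ Mb≡z i ⟩
            z i                        ∎
            where open ≡-Reasoning

          M′-restrict : ∀ i → (M′ *ᵛ restrict S′ b) i ≡ (M′ *ᵛ b) i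
          M′-restrict i = sum-cong-≋ pointwise
            where
            pointwise : ∀ j → M′ i j * restrict S′ b j ≡ M′ i j * b j
            pointwise j with j ∈? S′ | j ≟ σ
            ... | yes j∈S′ | _        = cong (M′ i j *_) (restrict-∈ b j∈S′)
            ... | no  j∉S′ | yes refl = begin
              M′ i σ * restrict S′ b σ  ≡⟨ cong (M′ i σ *_) (restrict-∉ b j∉S′) ⟩
              M′ i σ * 0ℤ               ≡⟨ ℤ.*-zeroʳ (M′ i σ) ⟩
              0ℤ                        ≡⟨ cong (_* b σ) (M′-column-σ i) ⟨
              M′ i σ * b σ              ∎
              where open ≡-Reasoning
            ... | no  j∉S′ | no  j≢σ  = cong (M′ i j *_) (trans (restrict-∉ b j∉S′) (sym (b∈S j (∉S′⇒∉S j≢σ j∉S′))))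

      saturated : Saturated M S → Saturated M′ S′
      saturated sat z N Nz∈span@(c , c∈S′ , M′c≡Nz) =
        descend (u-annihilates-span z N Nz∈span) (sat z N (project c , project-supported c∈S′ , λ i → trans (sym (*ᵛ-M′ c i)) (M′c≡Nz i)))

      dual-basis-lift : ∀ y′ → IsDualBasis M′ S′ y′ → ∃ (IsDualBasis M S)
      dual-basis-lift y′ y′-dual = y , dual
        where
        lower : Fin n → Fin m → ℤ
        lower a i = y′ a i - (y′ a ᵛ* M) σ * u i

        lower-ᵛ* : ∀ a τ → (lower a ᵛ* M) τ ≡ (y′ a ᵛ* M′) τ
        lower-ᵛ* a τ = begin
          (lower a ᵛ* M) τ                                       ≡⟨ ᵛ*-+ M (y′ a) (λ i → - ((y′ a ᵛ* M) σ * u i)) τ ⟩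
          (y′ a ᵛ* M) τ + ((λ i → - ((y′ a ᵛ* M) σ * u i)) ᵛ* M) τ ≡⟨ cong (_+_ ((y′ a ᵛ* M) τ)) (ᵛ*-neg M (λ i → (y′ a ᵛ* M) σ * u i) τ) ⟩
          (y′ a ᵛ* M) τ - ((λ i → (y′ a ᵛ* M) σ * u i) ᵛ* M) τ   ≡⟨ cong (λ t → (y′ a ᵛ* M) τ - t) (ᵛ*-scale M ((y′ a ᵛ* M) σ) u τ) ⟩
          (y′ a ᵛ* M) τ - (y′ a ᵛ* M) σ * w τ                   ≡⟨ cong (λ t → (y′ a ᵛ* M) τ - t) (ℤ.*-comm ((y′ a ᵛ* M) σ) (w τ)) ⟩
          (y′ a ᵛ* M) τ - w τ * (y′ a ᵛ* M) σ                   ≡⟨ ᵛ*-M′ (y′ a) τ ⟨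
          (y′ a ᵛ* M′) τ                                         ∎
          where open ≡-Reasoning

        w′ : Fin n → ℤ
        w′ = restrict S′ w

        w′-expansion : ∀ τ → τ ∈ S′ → sum (λ a → w′ a * (y′ a ᵛ* M′) τ) ≡ w τ
        w′-expansion τ τ∈S′ = begin
          sum (λ a → w′ a * (y′ a ᵛ* M′) τ) ≡⟨ sum-single (λ a → w′ a * (y′ a ᵛ* M′) τ) τ off-τ ⟩
          w′ τ * (y′ τ ᵛ* M′) τ             ≡⟨ cong₂ _*_ (restrict-∈ w τ∈S′) (trans (y′-dual τ τ τ∈S′ τ∈S′) (δ-diag τ)) ⟩
          w τ * 1ℤ                          ≡⟨ ℤ.*-identityʳ (w τ) ⟩
          w τ                               ∎
          where
          open ≡-Reasoning
          off-τ : ∀ a → a ≢ τ → w′ a * (y′ a ᵛ* M′) τ ≡ 0ℤ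
          off-τ a a≢τ = by-cases (a ∈? S′)
            where
            by-cases : Dec (a ∈ S′) → w′ a * (y′ a ᵛ* M′) τ ≡ 0ℤ
            by-cases (yes a∈S′) = trans (cong (w′ a *_) (trans (y′-dual a τ a∈S′ τ∈S′) (δ-off a≢τ))) (ℤ.*-zeroʳ (w′ a))
            by-cases (no  a∉S′) = cong (_* (y′ a ᵛ* M′) τ) (restrict-∉ w a∉S′)

        top : Fin m → ℤ
        top i = u i - sum (λ a → w′ a * lower a i)

        top-ᵛ* : ∀ τ → (top ᵛ* M) τ ≡ w τ - sum (λ a → w′ a * (y′ a ᵛ* M′) τ)
        top-ᵛ* τ = begin
          (top ᵛ* M) τ                                            ≡⟨ ᵛ*-+ M u (λ i → - sum (λ a → w′ a * lower a i)) τ ⟩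
          w τ + ((λ i → - sum (λ a → w′ a * lower a i)) ᵛ* M) τ  ≡⟨ cong (_+_ (w τ)) (ᵛ*-neg M (λ i → sum (λ a → w′ a * lower a i)) τ) ⟩
          w τ - ((λ i → sum (λ a → w′ a * lower a i)) ᵛ* M) τ    ≡⟨ cong (λ t → w τ - t) (ᵛ*-sum M w′ lower τ) ⟩
          w τ - sum (λ a → w′ a * (lower a ᵛ* M) τ)               ≡⟨ cong (λ t → w τ - t) (sum-cong-≋ λ a → cong (w′ a *_) (lower-ᵛ* a τ)) ⟩
          w τ - sum (λ a → w′ a * (y′ a ᵛ* M′) τ)                 ∎
          where open ≡-Reasoning

        y : Fin n → Fin m → ℤ
        y a with a ≟ σ
        ... | yes _ = top
        ... | no  _ = lower a

        dual : IsDualBasis M S y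
        dual a τ a∈S τ∈S with a ≟ σ | τ ≟ σ
        ... | yes refl | yes refl = begin
          (top ᵛ* M) σ
            ≡⟨ top-ᵛ* σ ⟩
          w σ - sum (λ a → w′ a * (y′ a ᵛ* M′) σ)
            ≡⟨ cong₂ _-_ uMσ≡1 (sum-zero (λ a → w′ a * (y′ a ᵛ* M′) σ) λ a → trans (cong (w′ a *_) (ᵛ*-M′-σ (y′ a))) (ℤ.*-zeroʳ (w′ a))) ⟩
          1ℤ - 0ℤ
            ≡⟨ δ-diag σ ⟨
          δ σ σ ∎
          where open ≡-Reasoning
        ... | yes refl | no τ≢σ = begin
          (top ᵛ* M) τ                                   ≡⟨ top-ᵛ* τ ⟩
          w τ - sum (λ a → w′ a * (y′ a ᵛ* M′) τ)        ≡⟨ cong (λ t → w τ - t) (w′-expansion τ (x∈p∧x≢y⇒x∈p-y τ∈S τ≢σ)) ⟩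
          w τ - w τ                                      ≡⟨ ℤ.+-inverseʳ (w τ) ⟩
          0ℤ                                             ≡⟨ δ-off (τ≢σ ∘ sym) ⟨
          δ σ τ                                          ∎
          where open ≡-Reasoning
        ... | no a≢σ | yes refl =
          trans (lower-ᵛ* a σ) (trans (ᵛ*-M′-σ (y′ a)) (sym (δ-off a≢σ)))
        ... | no a≢σ | no τ≢σ =
          trans (lower-ᵛ* a τ) (y′-dual a τ (x∈p∧x≢y⇒x∈p-y a∈S a≢σ) (x∈p∧x≢y⇒x∈p-y τ∈S τ≢σ))

  dual-basis : ∀ {m n} {M : Fin m → Fin n → ℤ} {S} → Independent M S → Saturated M S → ∃ (IsDualBasis M S)
  dual-basis {S = S} = go (size S) ℕ.≤-refl
    where
    go : ∀ k {m n} {M : Fin m → Fin n → ℤ} {S} → size S ℕ.≤ k →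
         Independent M S → Saturated M S → ∃ (IsDualBasis M S)
    go k {M = M} {S} ∣S∣≤k ind sat with nonempty? S | k
    ... | no S-empty | _ = (λ _ _ → 0ℤ) , λ σ _ σ∈S _ → contradiction (σ , σ∈S) S-empty
    ... | yes (σ , σ∈S) | zero = contradiction (ℕ.<-≤-trans (x∈p⇒∣p-x∣<∣p∣ σ∈S) ∣S∣≤k) ℕ.n≮0
    ... | yes (σ , σ∈S) | suc k′ =
      let u , uMσ≡1 = unimodular-functional {M = M} ind sat σ∈S
          open Projection M σ u uMσ≡1
      in uncurry (dual-basis-lift σ∈S) (go k′ (ℕ.≤-pred (ℕ.<-≤-trans (x∈p⇒∣p-x∣<∣p∣ σ∈S) ∣S∣≤k))
                                            (independent σ∈S ind) (saturated σ∈S sat))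

module RationalEmbedding where

  open import Data.Nat using (zero; suc)
  open import Data.Nat.Coprimality using (1-coprimeTo) renaming (sym to coprime-sym)
  open import Data.Integer as ℤ using (ℤ; +_; -[1+_]; +[1+_]; 0ℤ; 1ℤ; -1ℤ; _+_; _*_)
  import Data.Integer.Properties as ℤ
  open import Data.Rational as ℚ using (ℚ; mkℚ; 0ℚ; 1ℚ)
  import Data.Rational.Properties as ℚ
  import Data.Rational.Unnormalised as ℚᵘ
  import Data.Rational.Unnormalised.Properties as ℚᵘ
  open import Data.Product using (∃; _,_)
  open import Relation.Binary.PropositionalEquality

  open MatrixAlgebra ℤ.+-*-commutativeRing
  module ℚᴹ = MatrixAlgebra ℚ.+-*-commutativeRing

  private
    canonical : ℤ → ℚ
    canonical z = mkℚ z 0 (coprime-sym (1-coprimeTo _))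

    toℚ≡canonical : ∀ z → toℚ z ≡ canonical z
    toℚ≡canonical z = ℚ.↥p/↧p≡p (canonical z)

  toℚ-+ : ∀ a b → toℚ (a + b) ≡ toℚ a ℚ.+ toℚ b
  toℚ-+ a b rewrite toℚ≡canonical (a + b) | toℚ≡canonical a | toℚ≡canonical b =
    ℚ.toℚᵘ-injective (ℚᵘ.≃-trans (ℚᵘ.*≡* eq) (ℚᵘ.≃-sym (ℚ.toℚᵘ-homo-+ (canonical a) (canonical b))))
    where
    eq : (a + b) * + 1 ≡ (a * + 1 + b * + 1) * + 1
    eq rewrite ℤ.*-identityʳ (a + b) | ℤ.*-identityʳ a | ℤ.*-identityʳ b | ℤ.*-identityʳ (a + b) = refl

  toℚ-* : ∀ a b → toℚ (a * b) ≡ toℚ a ℚ.* toℚ b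
  toℚ-* a b rewrite toℚ≡canonical (a * b) | toℚ≡canonical a | toℚ≡canonical b =
    ℚ.toℚᵘ-injective (ℚᵘ.≃-trans (ℚᵘ.*≡* refl) (ℚᵘ.≃-sym (ℚ.toℚᵘ-homo-* (canonical a) (canonical b))))

  toℚ-injective : ∀ {a b} → toℚ a ≡ toℚ b → a ≡ b
  toℚ-injective {a} {b} eq = cong ℚ.numerator (trans (sym (toℚ≡canonical a)) (trans eq (toℚ≡canonical b)))

  toℚ-sum : ∀ {n} (f : Fin n → ℤ) → toℚ (sum f) ≡ ℚᴹ.sum (toℚ ∘ f)
  toℚ-sum {zero}  f = refl
  toℚ-sum {suc n} f = trans (toℚ-+ (f zero) (sum (f ∘ suc))) (cong (toℚ (f zero) ℚ.+_) (toℚ-sum (f ∘ suc)))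

  toℚ-positive : ∀ x → 0ℚ ℚ.< toℚ x → x ≡ 1ℤ * + ℤ.∣ x ∣
  toℚ-positive (+ k)    _   = sym (ℤ.*-identityˡ (+ k))
  toℚ-positive -[1+ k ] 0<x =
    contradiction (subst (ℚ._< 0ℚ) (sym (toℚ≡canonical -[1+ k ])) (ℚ.negative⁻¹ (canonical -[1+ k ]))) (ℚ.<-asym 0<x)

  toℚ-negative : ∀ x → toℚ x ℚ.< 0ℚ → x ≡ -1ℤ * + ℤ.∣ x ∣
  toℚ-negative -[1+ k ] _   = sym (ℤ.-1*i≡-i (+ suc k))
  toℚ-negative (+ k)    x<0 =
    contradiction (ℚ.≤-<-trans (subst (0ℚ ℚ.≤_) (sym (toℚ≡canonical (+ k))) (ℚ.nonNegative⁻¹ (canonical (+ k)))) x<0)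
                  (ℚ.<-irrefl refl)

  toℚ-invertible : ∀ z → z ≢ 0ℤ → ∃ λ r → toℚ z ℚ.* r ≡ 1ℚ
  toℚ-invertible (+ 0)     z≢0 = contradiction refl z≢0
  toℚ-invertible +[1+ k ] _   = ℚ.1/ canonical +[1+ k ] ,
    trans (cong (ℚ._* ℚ.1/ canonical +[1+ k ]) (toℚ≡canonical +[1+ k ])) (ℚ.*-inverseʳ (canonical +[1+ k ]))
  toℚ-invertible -[1+ k ] _   = ℚ.1/ canonical -[1+ k ] ,
    trans (cong (ℚ._* ℚ.1/ canonical -[1+ k ]) (toℚ≡canonical -[1+ k ])) (ℚ.*-inverseʳ (canonical -[1+ k ]))

  toℚ-cancelʳ : ∀ x z → z ≢ 0ℤ → x ℚ.* toℚ z ≡ 0ℚ → x ≡ 0ℚ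
  toℚ-cancelʳ x z z≢0 xz≡0 = begin
    x                           ≡⟨ ℚ.*-identityʳ x ⟨
    x ℚ.* 1ℚ                    ≡⟨ cong (x ℚ.*_) z·r≡1 ⟨
    x ℚ.* (toℚ z ℚ.* r)         ≡⟨ ℚ.*-assoc x (toℚ z) r ⟨
    x ℚ.* toℚ z ℚ.* r           ≡⟨ cong (ℚ._* r) xz≡0 ⟩
    0ℚ ℚ.* r                    ≡⟨ ℚ.*-zeroˡ r ⟩
    0ℚ                          ∎
    where
    open ≡-Reasoning
    r = proj₁ (toℚ-invertible z z≢0)
    z·r≡1 = proj₂ (toℚ-invertible z z≢0)

  factor-positive : ∀ {a p} → 0ℚ ℚ.< p → 0ℚ ℚ.< a ℚ.* p → 0ℚ ℚ.< a
  factor-positive {a} {p} 0<p 0<ap =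
    ℚ.*-cancelʳ-<-nonNeg p {{ℚ.pos⇒nonNeg p {{ℚ.positive 0<p}}}} (subst (ℚ._< a ℚ.* p) (sym (ℚ.*-zeroˡ p)) 0<ap)

  factor-negative : ∀ {a p} → 0ℚ ℚ.< p → a ℚ.* p ℚ.< 0ℚ → a ℚ.< 0ℚ
  factor-negative {a} {p} 0<p ap<0 =
    ℚ.*-cancelʳ-<-nonNeg p {{ℚ.pos⇒nonNeg p {{ℚ.positive 0<p}}}} (subst (a ℚ.* p ℚ.<_) (sym (ℚ.*-zeroˡ p)) ap<0)

  toℚ-δ : ∀ {n} (a b : Fin n) → toℚ (δ a b) ≡ ℚᴹ.δ a b
  toℚ-δ a b with a ≟ b
  ... | yes refl = trans (cong toℚ (δ-diag a)) (sym (ℚᴹ.δ-diag a))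
  ... | no  a≢b  = trans (cong toℚ (δ-off a≢b)) (sym (ℚᴹ.δ-off a≢b))

module SpanningForests where

  open import Data.Nat as ℕ using (ℕ; zero; suc)
  import Data.Nat.Properties as ℕ
  import Data.Nat.DivMod as ℕ
  import Data.Nat.Divisibility as ℕ
  open import Data.Integer as ℤ using (ℤ; +_; 0ℤ; 1ℤ; -1ℤ; _+_; _*_; -_; _-_)
  import Data.Integer.Properties as ℤ
  open import Data.Integer.Divisibility.Signed using (_∣_; divides; ∣⇒∣ᵤ; ∣-trans; ∣m∣∣m; m∣∣m∣; ∣m⇒∣m*n; ∣m∣n⇒∣m-n)
  open import Data.Integer.DivMod using (a≡a%ℕn+[a/ℕn]*n; n%ℕd<d)
  open import Data.Integer.Tactic.RingSolver using (solve-∀)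
  open import Data.Rational as ℚ using (ℚ; 0ℚ; 1ℚ)
  import Data.Rational.Properties as ℚ
  open import Data.Bool using (true; false)
  open import Data.Fin using (toℕ; fromℕ<)
  open import Data.Fin.Subset using (_─_; _∪_; ⁅_⁆)
  open import Data.Fin.Subset.Properties using (x∈p∧x≢y⇒x∈p-y; x∈p∪q⁻; x∈p∪q⁺; p─q⊆p; x∈⁅y⁆⇒x≡y; x∈⁅x⁆; x∉⁅y⁆⇒x≢y)
  import Data.Vec as Vec
  open import Data.Vec.Properties using ([]=⇒lookup; lookup⇒[]=)
  open import Data.Product using (∃; _,_)
  open import Data.Sum using (_⊎_; inj₁; inj₂)
  open import Relation.Binary.PropositionalEquality
  open import Relation.Nullary using (Dec)
  open import Algebra.Properties.CommutativeSemigroup ℤ.*-commutativeSemigroup using (x∙yz≈y∙xz)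
  open IntegralLattices
  open RationalEmbedding

  open MatrixAlgebra ℤ.+-*-commutativeRing

  sumℤ≡sum : ∀ {n} (f : Fin n → ℤ) → sumℤ f ≡ sum f
  sumℤ≡sum {zero}  f = refl
  sumℤ≡sum {suc n} f = cong (_+_ (f zero)) (sumℤ≡sum (f ∘ suc))

  sumℚ≡sum : ∀ {n} (f : Fin n → ℚ) → sumℚ f ≡ ℚᴹ.sum f
  sumℚ≡sum {zero}  f = refl
  sumℚ≡sum {suc n} f = cong (f zero ℚ.+_) (sumℚ≡sum (f ∘ suc))

  sumℤ-cong : ∀ {n} (f g : Fin n → ℤ) → (∀ i → f i ≡ g i) → sumℤ f ≡ sumℤ g
  sumℤ-cong f g f≗g = trans (sumℤ≡sum f) (trans (sum-cong-≋ f≗g) (sym (sumℤ≡sum g)))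

  module Chains (Σc : CellComplex) where

    open CellComplex Σc

    bdᵠ : Fin m → Fin n → ℚ
    bdᵠ i j = toℚ (bd i j)

    bdℤ≡*ᵛ : ∀ c i → bdℤ Σc c i ≡ (bd *ᵛ c) i
    bdℤ≡*ᵛ c i = sumℤ≡sum (λ j → bd i j * c j)

    bdℚ≡*ᵛ : ∀ c i → bdℚ Σc c i ≡ (bdᵠ ℚᴹ.*ᵛ c) i
    bdℚ≡*ᵛ c i = sumℚ≡sum (λ j → bdᵠ i j ℚ.* c j)

    cobd≡ᵛ* : ∀ y j → cobd Σc y j ≡ (y ᵛ* bd) j
    cobd≡ᵛ* y j = trans (sumℤ≡sum (λ i → bd i j * y i)) (sum-cong-≋ λ i → ℤ.*-comm (bd i j) (y i))

    pair≡ᵛ* : ∀ φ j → pair Σc φ j ≡ (φ ℚᴹ.ᵛ* bdᵠ) j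
    pair≡ᵛ* φ j = sumℚ≡sum (λ i → φ i ℚ.* bdᵠ i j)

    *ᵛ-toℚ : ∀ c i → (bdᵠ ℚᴹ.*ᵛ (toℚ ∘ c)) i ≡ toℚ ((bd *ᵛ c) i)
    *ᵛ-toℚ c i = trans (ℚᴹ.sum-cong-≋ λ j → sym (toℚ-* (bd i j) (c j))) (sym (toℚ-sum (λ j → bd i j * c j)))

    ᵛ*-toℚ : ∀ y j → ((toℚ ∘ y) ℚᴹ.ᵛ* bdᵠ) j ≡ toℚ ((y ᵛ* bd) j)
    ᵛ*-toℚ y j = trans (ℚᴹ.sum-cong-≋ λ i → sym (toℚ-* (y i) (bd i j))) (sym (toℚ-sum (λ i → y i * bd i j)))

    boundary-is-cycle : ∀ c → InCycles Σc (bd *ᵛ c)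
    boundary-is-cycle c l = begin
      sumℤ (λ i → bd' l i * (bd *ᵛ c) i)   ≡⟨ sumℤ≡sum (λ i → bd' l i * (bd *ᵛ c) i) ⟩
      sum (λ i → bd' l i * (bd *ᵛ c) i)    ≡⟨ ᵛ*-*ᵛ bd (bd' l) c ⟩
      sum (λ j → (bd' l ᵛ* bd) j * c j)    ≡⟨ sum-zero (λ j → (bd' l ᵛ* bd) j * c j) (λ j → cong (_* c j) ∂∂≡0) ⟩
      0ℤ                                   ∎
      where
      open ≡-Reasoning
      ∂∂≡0 : ∀ {j} → (bd' l ᵛ* bd) j ≡ 0ℤ
      ∂∂≡0 {j} = trans (sym (sumℤ≡sum (λ i → bd' l i * bd i j))) (bd∘bd≡0 l j)

    inSpan⇒cycle : ∀ {S z} → InSpan bd S z → InCycles Σc z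
    inSpan⇒cycle {z = z} (c , _ , ∂c≡z) l =
      trans (sumℤ-cong (λ i → bd' l i * z i) (λ i → bd' l i * (bd *ᵛ c) i) (λ i → cong (bd' l i *_) (sym (∂c≡z i))))
            (boundary-is-cycle c l)

    InBoundaries-cong : ∀ {X z z′} → (∀ i → z i ≡ z′ i) → InBoundaries Σc X z → InBoundaries Σc X z′
    InBoundaries-cong z≗z′ (c , c∈X , ∂c≡z) = c , c∈X , λ i → trans (∂c≡z i) (z≗z′ i)

    cycle-of-multiple : ∀ N z → InCycles Σc (λ i → + suc N * z i) → InCycles Σc z
    cycle-of-multiple N z cycle l = ℤ.*-cancelˡ-≡ (+ suc N) (sumℤ λ i → bd' l i * z i) 0ℤ (trans N·∂z≡0 (sym (ℤ.*-zeroʳ (+ suc N))))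
      where
      N·∂z≡0 : + suc N * sumℤ (λ i → bd' l i * z i) ≡ 0ℤ
      N·∂z≡0 = begin
        + suc N * sumℤ (λ i → bd' l i * z i)   ≡⟨ cong (+ suc N *_) (sumℤ≡sum (λ i → bd' l i * z i)) ⟩
        + suc N * sum (λ i → bd' l i * z i)    ≡⟨ *-distribˡ-sum (+ suc N) (λ i → bd' l i * z i) ⟩
        sum (λ i → + suc N * (bd' l i * z i))  ≡⟨ sum-cong-≋ (λ i → x∙yz≈y∙xz (+ suc N) (bd' l i) (z i)) ⟩
        sum (λ i → bd' l i * (+ suc N * z i))  ≡⟨ sumℤ≡sum (λ i → bd' l i * (+ suc N * z i)) ⟨
        sumℤ (λ i → bd' l i * (+ suc N * z i)) ≡⟨ cycle l ⟩
        0ℤ                                     ∎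
        where open ≡-Reasoning

    IsCSF-cong : ∀ {S S′} → (∀ {j} → j ∈ S → j ∈ S′) → (∀ {j} → j ∈ S′ → j ∈ S) → IsCSF Σc S → IsCSF Σc S′
    IsCSF-cong S⊆S′ S′⊆S (indep , spans) =
      (λ c c∈S′ → indep c (λ j j∉S → c∈S′ j (j∉S ∘ S′⊆S))) ,
      λ c → let c′ , c′∈S , ∂c′≡∂c = spans c in c′ , (λ j j∉S′ → c′∈S j (j∉S′ ∘ S⊆S′)) , ∂c′≡∂c

    linIndep⇒independent : ∀ {S} → LinIndep Σc S → Independent bd S
    linIndep⇒independent indep c c∈S ∂c≡0 j = toℚ-injective (indep (toℚ ∘ c) (λ j j∉S → cong toℚ (c∈S j j∉S))
      (λ i → trans (bdℚ≡*ᵛ (toℚ ∘ c) i) (trans (*ᵛ-toℚ c i) (cong toℚ (∂c≡0 i)))) j)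

    torsionFree⇒saturated : ∀ {S} → TorsionFree Σc S → Saturated bd S
    torsionFree⇒saturated tf z N (c , c∈S , ∂c≡Nz) with tf z (cycle , N , c , c∈S , λ i → trans (bdℤ≡*ᵛ c i) (∂c≡Nz i))
      where
      cycle : InCycles Σc z
      cycle = cycle-of-multiple N z (inSpan⇒cycle (c , c∈S , ∂c≡Nz))
    ... | c′ , c′∈S , ∂c′≡z = c′ , c′∈S , λ i → trans (sym (bdℤ≡*ᵛ c′ i)) (trans (∂c′≡z i) (ℤ.+-identityʳ (z i)))

  module Coordinates (Σc : CellComplex) (Υ : Subset (CellComplex.n Σc))
                     (csf : IsCSF Σc Υ) (tf : TorsionFree Σc Υ) where

    open CellComplex Σc
    open Chains Σc

    abstract
      dual : ∃ (IsDualBasis bd Υ)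
      dual = dual-basis (linIndep⇒independent (proj₁ csf)) (torsionFree⇒saturated tf)

    y : Fin n → Fin m → ℤ
    y = proj₁ dual

    y-dual : IsDualBasis bd Υ y
    y-dual = proj₂ dual

    q : Fin n → Fin n → ℤ
    q σ ρ = (y σ ᵛ* bd) ρ

    coordinates : Fin n → Fin n → ℤ
    coordinates ρ = restrict Υ (λ τ → q τ ρ)

    expansion : ∀ ρ i → (bd *ᵛ coordinates ρ) i ≡ bd i ρ
    expansion ρ i = toℚ-injective (begin
      toℚ ((bd *ᵛ coordinates ρ) i)           ≡⟨ *ᵛ-toℚ (coordinates ρ) i ⟨
      (bdᵠ ℚᴹ.*ᵛ (toℚ ∘ coordinates ρ)) i     ≡⟨ ℚᴹ.*ᵛ-cong bdᵠ (λ τ → sym (c′≡coordinates τ)) i ⟩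
      (bdᵠ ℚᴹ.*ᵛ c′) i                        ≡⟨ ∂c′≡∂ρ i ⟩
      toℚ (bd i ρ)                            ∎)
      where
      open ≡-Reasoning
      spanned = proj₂ csf (toℚ ∘ δ ρ)
      c′ = proj₁ spanned
      c′∈Υ = proj₁ (proj₂ spanned)

      ∂c′≡∂ρ : ∀ i → (bdᵠ ℚᴹ.*ᵛ c′) i ≡ toℚ (bd i ρ)
      ∂c′≡∂ρ i = begin
        (bdᵠ ℚᴹ.*ᵛ c′) i            ≡⟨ bdℚ≡*ᵛ c′ i ⟨
        bdℚ Σc c′ i                 ≡⟨ proj₂ (proj₂ spanned) i ⟩
        bdℚ Σc (toℚ ∘ δ ρ) i        ≡⟨ bdℚ≡*ᵛ (toℚ ∘ δ ρ) i ⟩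
        (bdᵠ ℚᴹ.*ᵛ (toℚ ∘ δ ρ)) i   ≡⟨ *ᵛ-toℚ (δ ρ) i ⟩
        toℚ ((bd *ᵛ δ ρ) i)         ≡⟨ cong toℚ (*ᵛ-δ bd ρ i) ⟩
        toℚ (bd i ρ)                ∎

      c′≡coordinates : ∀ τ → c′ τ ≡ toℚ (coordinates ρ τ)
      c′≡coordinates τ with τ ∈? Υ
      ... | no  τ∉Υ = trans (c′∈Υ τ τ∉Υ) (cong toℚ (sym (restrict-∉ (λ τ → q τ ρ) τ∉Υ)))
      ... | yes τ∈Υ = begin
        c′ τ                                                ≡⟨ ℚᴹ.dual-coordinate bdᵠ (toℚ ∘ y τ) c′ τ∈Υ dualᵠ c′∈Υ ⟨
        ℚᴹ.sum (λ i → toℚ (y τ i) ℚ.* (bdᵠ ℚᴹ.*ᵛ c′) i)    ≡⟨ ℚᴹ.sum-cong-≋ (λ i → cong (toℚ (y τ i) ℚ.*_) (∂c′≡∂ρ i)) ⟩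
        ((toℚ ∘ y τ) ℚᴹ.ᵛ* bdᵠ) ρ                           ≡⟨ ᵛ*-toℚ (y τ) ρ ⟩
        toℚ (q τ ρ)                                         ≡⟨ cong toℚ (restrict-∈ (λ τ → q τ ρ) τ∈Υ) ⟨
        toℚ (coordinates ρ τ)                               ∎
        where
        dualᵠ : ∀ τ′ → τ′ ∈ Υ → ((toℚ ∘ y τ) ℚᴹ.ᵛ* bdᵠ) τ′ ≡ ℚᴹ.δ τ τ′
        dualᵠ τ′ τ′∈Υ = trans (ᵛ*-toℚ (y τ) τ′) (trans (cong toℚ (y-dual τ τ′ τ∈Υ τ′∈Υ)) (toℚ-δ τ τ′))

    module _ (χ : Fin n → Fin n → ℤ) (χ≡q : ∀ σ → σ ∈ Υ → ∀ ρ → χ σ ρ ≡ q σ ρ) where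

      private
        χ-coboundary : ∀ σ → σ ∈ Υ → ∃ λ y₀ → ∀ j → χ σ j ≡ cobd Σc y₀ j
        χ-coboundary σ σ∈Υ = y σ , λ j → trans (χ≡q σ σ∈Υ j) (sym (cobd≡ᵛ* (y σ) j))

        χ-independent : ∀ a → SupportedOnℤ Σc Υ a → (∀ j → sumℤ (λ σ → a σ * χ σ j) ≡ 0ℤ) → ∀ σ → a σ ≡ 0ℤ
        χ-independent a a∈Υ ∑aχ≡0 σ₀ with σ₀ ∈? Υ
        ... | no  σ₀∉Υ = a∈Υ σ₀ σ₀∉Υ
        ... | yes σ₀∈Υ = begin
          a σ₀                            ≡⟨ ℤ.*-identityʳ (a σ₀) ⟨
          a σ₀ * 1ℤ                       ≡⟨ cong (a σ₀ *_) (trans (trans (χ≡q σ₀ σ₀∈Υ σ₀) (y-dual σ₀ σ₀ σ₀∈Υ σ₀∈Υ)) (δ-diag σ₀)) ⟨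
          a σ₀ * χ σ₀ σ₀                  ≡⟨ sum-single (λ σ → a σ * χ σ σ₀) σ₀ off-σ₀ ⟨
          sum (λ σ → a σ * χ σ σ₀)        ≡⟨ sumℤ≡sum (λ σ → a σ * χ σ σ₀) ⟨
          sumℤ (λ σ → a σ * χ σ σ₀)       ≡⟨ ∑aχ≡0 σ₀ ⟩
          0ℤ                              ∎
          where
          open ≡-Reasoning
          off-σ₀ : ∀ σ → σ ≢ σ₀ → a σ * χ σ σ₀ ≡ 0ℤ
          off-σ₀ σ σ≢σ₀ with σ ∈? Υ
          ... | yes σ∈Υ = trans (cong (a σ *_) (trans (χ≡q σ σ∈Υ σ₀) (trans (y-dual σ σ₀ σ∈Υ σ₀∈Υ) (δ-off σ≢σ₀)))) (ℤ.*-zeroʳ (a σ))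
          ... | no  σ∉Υ = cong (_* χ σ σ₀) (a∈Υ σ σ∉Υ)

        χ-spans : ∀ y₀ → ∃ λ a → SupportedOnℤ Σc Υ a × (∀ j → cobd Σc y₀ j ≡ sumℤ (λ σ → a σ * χ σ j))
        χ-spans y₀ = a , (λ σ σ∉Υ → restrict-∉ (y₀ ᵛ* bd) σ∉Υ) , λ j → begin
          cobd Σc y₀ j                                    ≡⟨ cobd≡ᵛ* y₀ j ⟩
          sum (λ i → y₀ i * bd i j)                       ≡⟨ sum-cong-≋ (λ i → cong (y₀ i *_) (expansion j i)) ⟨
          sum (λ i → y₀ i * (bd *ᵛ coordinates j) i)      ≡⟨ ᵛ*-*ᵛ bd y₀ (coordinates j) ⟩
          sum (λ σ → (y₀ ᵛ* bd) σ * coordinates j σ)      ≡⟨ sum-cong-≋ (pointwise j) ⟩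
          sum (λ σ → a σ * χ σ j)                         ≡⟨ sumℤ≡sum (λ σ → a σ * χ σ j) ⟨
          sumℤ (λ σ → a σ * χ σ j)                        ∎
          where
          open ≡-Reasoning
          a = restrict Υ (y₀ ᵛ* bd)
          pointwise : ∀ j σ → (y₀ ᵛ* bd) σ * coordinates j σ ≡ a σ * χ σ j
          pointwise j σ = by-cases (σ ∈? Υ)
            where
            by-cases : Dec (σ ∈ Υ) → (y₀ ᵛ* bd) σ * coordinates j σ ≡ a σ * χ σ j
            by-cases (yes σ∈Υ) = cong₂ _*_ (sym (restrict-∈ (y₀ ᵛ* bd) σ∈Υ))
                                          (trans (restrict-∈ (λ τ → q τ j) σ∈Υ) (sym (χ≡q σ σ∈Υ j)))
            by-cases (no  σ∉Υ) = begin
              (y₀ ᵛ* bd) σ * coordinates j σ   ≡⟨ cong ((y₀ ᵛ* bd) σ *_) (restrict-∉ (λ τ → q τ j) σ∉Υ) ⟩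
              (y₀ ᵛ* bd) σ * 0ℤ                ≡⟨ ℤ.*-zeroʳ ((y₀ ᵛ* bd) σ) ⟩
              0ℤ                               ≡⟨ cong (_* χ σ j) (restrict-∉ (y₀ ᵛ* bd) σ∉Υ) ⟨
              a σ * χ σ j                      ∎

      cut-lattice-basis : IsCutLatticeBasis Σc Υ χ
      cut-lattice-basis = χ-coboundary , χ-independent , χ-spans

  module _ {n} {p : Subset n} {x y : Fin n} where

    ∈-exchange⁻ : ∀ {j} → j ∈ (p ─ ⁅ x ⁆) ∪ ⁅ y ⁆ → (j ∈ p × j ≢ x) ⊎ j ≡ y
    ∈-exchange⁻ j∈ with x∈p∪q⁻ (p ─ ⁅ x ⁆) ⁅ y ⁆ j∈
    ... | inj₁ j∈p-x = inj₁ (p─q⊆p p ⁅ x ⁆ j∈p-x , x∉⁅y⁆⇒x≢y (x∈p─q⇒x∉q p ⁅ x ⁆ j∈p-x))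
    ... | inj₂ j∈y   = inj₂ (x∈⁅y⁆⇒x≡y y j∈y)

    ∈-exchange⁺ : ∀ {j} → (j ∈ p × j ≢ x) ⊎ j ≡ y → j ∈ (p ─ ⁅ x ⁆) ∪ ⁅ y ⁆
    ∈-exchange⁺ (inj₁ (j∈p , j≢x)) = x∈p∪q⁺ (inj₁ (x∈p∧x≢y⇒x∈p-y j∈p j≢x))
    ∈-exchange⁺ (inj₂ refl)        = x∈p∪q⁺ (inj₂ (x∈⁅x⁆ y))

  small-difference : ∀ {a b Q} .{{_ : ℕ.NonZero Q}} → a ℕ.< Q → b ℕ.< Q → (+ Q) ∣ (+ a - + b) → a ≡ b
  small-difference {a} {b} {Q} a<Q b<Q Q∣a-b =
    ℤ.+-injective (ℤ.i-j≡0⇒i≡j (+ a) (+ b) (ℤ.∣i∣≡0⇒i≡0 ∣a-b∣≡0))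
    where
    ∣a-b∣<Q : ℤ.∣ + a - + b ∣ ℕ.< Q
    ∣a-b∣<Q = ℕ.≤-<-trans (ℕ.≤-reflexive (cong ℤ.∣_∣ (ℤ.m-n≡m⊖n a b)))
                          (ℕ.≤-<-trans (ℤ.∣m⊝n∣≤m⊔n a b) (ℕ.⊔-lub a<Q b<Q))
    ∣a-b∣≡0 : ℤ.∣ + a - + b ∣ ≡ 0
    ∣a-b∣≡0 = trans (sym (ℕ.m<n⇒m%n≡m ∣a-b∣<Q)) (ℕ.n∣m⇒m%n≡0 _ Q (∣⇒∣ᵤ Q∣a-b))

  same-residue⇒divisible : ∀ a b Q .{{_ : ℕ.NonZero Q}} → a ℤ.%ℕ Q ≡ b ℤ.%ℕ Q → (+ Q) ∣ (a - b)
  same-residue⇒divisible a b Q r≡r′ = divides (a ℤ./ℕ Q - b ℤ./ℕ Q) (begin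
    a - b                                               ≡⟨ cong₂ _-_ (a≡a%ℕn+[a/ℕn]*n a Q) (a≡a%ℕn+[a/ℕn]*n b Q) ⟩
    (+ r + a ℤ./ℕ Q * + Q) - (+ r′ + b ℤ./ℕ Q * + Q)    ≡⟨ cong (λ s → (+ r + a ℤ./ℕ Q * + Q) - (+ s + b ℤ./ℕ Q * + Q)) r≡r′ ⟨
    (+ r + a ℤ./ℕ Q * + Q) - (+ r + b ℤ./ℕ Q * + Q)     ≡⟨ cancel (+ r) (a ℤ./ℕ Q) (b ℤ./ℕ Q) (+ Q) ⟩
    (a ℤ./ℕ Q - b ℤ./ℕ Q) * + Q                         ∎)
    where
    open ≡-Reasoning
    r = a ℤ.%ℕ Q
    r′ = b ℤ.%ℕ Q
    cancel : ∀ r x y Q → (r + x * Q) - (r + y * Q) ≡ (x - y) * Q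
    cancel = solve-∀

  module Exchange (Σc : CellComplex) (Υ : Subset (CellComplex.n Σc))
                  (csf : IsCSF Σc Υ) (tf : TorsionFree Σc Υ)
                  (σ : Fin (CellComplex.n Σc)) (σ∈Υ : σ ∈ Υ) (ρ : Fin (CellComplex.n Σc)) where

    open CellComplex Σc
    open Chains Σc
    open Coordinates Σc Υ csf tf

    X : Subset n
    X = (Υ ─ ⁅ σ ⁆) ∪ ⁅ ρ ⁆

    private
      ∈Υ∖σ⇒∈X : ∀ {j} → j ∈ Υ → j ≢ σ → j ∈ X
      ∈Υ∖σ⇒∈X j∈Υ j≢σ = ∈-exchange⁺ (inj₁ (j∈Υ , j≢σ))

      ∉X⇒≢ρ : ∀ {j} → j ∉ X → j ≢ ρ
      ∉X⇒≢ρ j∉X j≡ρ = j∉X (∈-exchange⁺ (inj₂ j≡ρ))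

    circuit : Fin n → ℤ
    circuit j = coordinates ρ j - δ ρ j

    ∂circuit≡0 : ∀ i → (bd *ᵛ circuit) i ≡ 0ℤ
    ∂circuit≡0 i = begin
      (bd *ᵛ circuit) i                                       ≡⟨ *ᵛ-+ bd (coordinates ρ) (λ j → - δ ρ j) i ⟩
      (bd *ᵛ coordinates ρ) i + (bd *ᵛ (λ j → - δ ρ j)) i     ≡⟨ cong₂ _+_ (expansion ρ i) (*ᵛ-neg bd (δ ρ) i) ⟩
      bd i ρ - (bd *ᵛ δ ρ) i                                  ≡⟨ cong (λ t → bd i ρ - t) (*ᵛ-δ bd ρ i) ⟩
      bd i ρ - bd i ρ                                         ≡⟨ ℤ.+-inverseʳ (bd i ρ) ⟩
      0ℤ                                                      ∎
      where open ≡-Reasoning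

    circuit-σ : ρ ≢ σ → circuit σ ≡ q σ ρ
    circuit-σ ρ≢σ = trans (cong₂ _-_ (restrict-∈ (λ τ → q τ ρ) σ∈Υ) (δ-off ρ≢σ)) (ℤ.+-identityʳ (q σ ρ))

    circuit-ρ : ρ ∉ Υ → circuit ρ ≡ -1ℤ
    circuit-ρ ρ∉Υ = cong₂ _-_ (restrict-∉ (λ τ → q τ ρ) ρ∉Υ) (δ-diag ρ)

    circuit-off : ∀ {j} → j ∉ Υ → j ≢ ρ → circuit j ≡ 0ℤ
    circuit-off j∉Υ j≢ρ = cong₂ _-_ (restrict-∉ (λ τ → q τ ρ) j∉Υ) (δ-off (j≢ρ ∘ sym))

    shift : (Fin n → ℤ) → ℤ → Fin n → ℤ
    shift c t j = c j + t * circuit j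

    ∂shift : ∀ c t i → (bd *ᵛ shift c t) i ≡ (bd *ᵛ c) i
    ∂shift = *ᵛ-add-kernel bd ∂circuit≡0

    σ-coordinate : (Fin m → ℤ) → ℤ
    σ-coordinate z = sum (λ i → y σ i * z i)

    σ-coordinate-cong : ∀ {z z′} → (∀ i → z i ≡ z′ i) → σ-coordinate z ≡ σ-coordinate z′
    σ-coordinate-cong z≗z′ = sum-cong-≋ (λ i → cong (y σ i *_) (z≗z′ i))

    σ-coordinate-sub : ∀ z z′ → σ-coordinate (λ i → z i - z′ i) ≡ σ-coordinate z - σ-coordinate z′
    σ-coordinate-sub z z′ = begin
      sum (λ i → y σ i * (z i - z′ i))                  ≡⟨ sum-cong-≋ (λ i → ℤ.*-distribˡ-+ (y σ i) (z i) (- z′ i)) ⟩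
      sum (λ i → y σ i * z i + y σ i * - z′ i)          ≡⟨ ∑-distrib-+ (λ i → y σ i * z i) (λ i → y σ i * - z′ i) ⟩
      σ-coordinate z + sum (λ i → y σ i * - z′ i)       ≡⟨ cong (_+_ (σ-coordinate z)) (sum-cong-≋ λ i → sym (ℤ.neg-distribʳ-* (y σ i) (z′ i))) ⟩
      σ-coordinate z + sum (λ i → - (y σ i * z′ i))     ≡⟨ cong (_+_ (σ-coordinate z)) (sum-neg (λ i → y σ i * z′ i)) ⟩
      σ-coordinate z - σ-coordinate z′                  ∎
      where open ≡-Reasoning

    σ-coordinate-Υ : ∀ a → Supported Υ a → σ-coordinate (bd *ᵛ a) ≡ a σ
    σ-coordinate-Υ a a∈Υ = dual-coordinate bd (y σ) a σ∈Υ (λ τ τ∈Υ → y-dual σ τ σ∈Υ τ∈Υ) a∈Υ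

    σ-coordinate-X : ∀ b → Supported X b → σ-coordinate (bd *ᵛ b) ≡ q σ ρ * b ρ
    σ-coordinate-X b b∈X = trans (ᵛ*-*ᵛ bd (y σ) b) (sum-single (λ j → q σ j * b j) ρ off-ρ)
      where
      off-ρ : ∀ j → j ≢ ρ → q σ j * b j ≡ 0ℤ
      off-ρ j j≢ρ with j ∈? X
      ... | no  j∉X = trans (cong (q σ j *_) (b∈X j j∉X)) (ℤ.*-zeroʳ (q σ j))
      ... | yes j∈X with ∈-exchange⁻ j∈X
      ...   | inj₂ j≡ρ         = contradiction j≡ρ j≢ρ
      ...   | inj₁ (j∈Υ , j≢σ) = cong (_* b j) (trans (y-dual σ j σ∈Υ j∈Υ) (δ-off (j≢σ ∘ sym)))

    homologous⇒divisible : ∀ z z′ → HomologousIn Σc X z z′ → q σ ρ ∣ σ-coordinate (λ i → z i - z′ i)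
    homologous⇒divisible z z′ (b , b∈X , ∂b≡z-z′) = divides (b ρ) (begin
      σ-coordinate (λ i → z i - z′ i)   ≡⟨ σ-coordinate-cong (λ i → trans (sym (∂b≡z-z′ i)) (bdℤ≡*ᵛ b i)) ⟩
      σ-coordinate (bd *ᵛ b)            ≡⟨ σ-coordinate-X b b∈X ⟩
      q σ ρ * b ρ                       ≡⟨ ℤ.*-comm (q σ ρ) (b ρ) ⟩
      b ρ * q σ ρ                       ∎)
      where open ≡-Reasoning

    divisible⇒homologous : ∀ z z′ → InSpan bd Υ (λ i → z i - z′ i) → q σ ρ ∣ σ-coordinate (λ i → z i - z′ i) →
                           HomologousIn Σc X z z′
    divisible⇒homologous z z′ (a , a∈Υ , ∂a≡z-z′) (divides k σ-coord≡kq) =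
      shift a (- k) , shifted-supported , λ i → trans (bdℤ≡*ᵛ (shift a (- k)) i) (trans (∂shift a (- k) i) (∂a≡z-z′ i))
      where
      aσ≡kq : a σ ≡ k * q σ ρ
      aσ≡kq = trans (sym (σ-coordinate-Υ a a∈Υ)) (trans (σ-coordinate-cong ∂a≡z-z′) σ-coord≡kq)

      shifted-supported : Supported X (shift a (- k))
      shifted-supported j j∉X with j ∈? Υ
      ... | no  j∉Υ = begin
        a j + - k * circuit j   ≡⟨ cong₂ (λ s t → s + - k * t) (a∈Υ j j∉Υ) (circuit-off j∉Υ (∉X⇒≢ρ j∉X)) ⟩
        0ℤ + - k * 0ℤ           ≡⟨ cong (_+_ 0ℤ) (ℤ.*-zeroʳ (- k)) ⟩
        0ℤ                      ∎
        where open ≡-Reasoning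
      ... | yes j∈Υ with j ≟ σ
      ...   | no  j≢σ  = contradiction (∈Υ∖σ⇒∈X j∈Υ j≢σ) j∉X
      ...   | yes refl = begin
        a σ + - k * circuit σ    ≡⟨ cong₂ (λ s t → s + - k * t) aσ≡kq (circuit-σ (∉X⇒≢ρ j∉X ∘ sym)) ⟩
        k * q σ ρ + - k * q σ ρ  ≡⟨ cancel k (q σ ρ) ⟩
        0ℤ                       ∎
        where
        open ≡-Reasoning
        cancel : ∀ k q → k * q + - k * q ≡ 0ℤ
        cancel = solve-∀

    torsion⇒inSpan : ∀ z → IsTorsionCycle Σc X z → InSpan bd Υ z
    torsion⇒inSpan z (_ , N , b , b∈X , ∂b≡Nz) =
      torsionFree⇒saturated tf z N (shift b (b ρ) , shifted-supported , λ i → trans (∂shift b (b ρ) i) (trans (sym (bdℤ≡*ᵛ b i)) (∂b≡Nz i)))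
      where
      shifted-supported : Supported Υ (shift b (b ρ))
      shifted-supported j j∉Υ with j ≟ ρ
      ... | yes refl = begin
        b ρ + b ρ * circuit ρ   ≡⟨ cong (λ t → b ρ + b ρ * t) (circuit-ρ j∉Υ) ⟩
        b ρ + b ρ * -1ℤ         ≡⟨ cancel (b ρ) ⟩
        0ℤ                      ∎
        where
        open ≡-Reasoning
        cancel : ∀ b → b + b * -1ℤ ≡ 0ℤ
        cancel = solve-∀
      ... | no  j≢ρ  = begin
        b j + b ρ * circuit j   ≡⟨ cong₂ (λ s t → s + b ρ * t) (b∈X j j∉X) (circuit-off j∉Υ j≢ρ) ⟩
        0ℤ + b ρ * 0ℤ           ≡⟨ cong (_+_ 0ℤ) (ℤ.*-zeroʳ (b ρ)) ⟩
        0ℤ                      ∎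
        where
        open ≡-Reasoning
        j∉X : j ∉ X
        j∉X j∈X with ∈-exchange⁻ j∈X
        ... | inj₁ (j∈Υ , _) = j∉Υ j∈Υ
        ... | inj₂ j≡ρ       = j≢ρ j≡ρ

    multiple : ℕ → Fin m → ℤ
    multiple k i = + k * bd i σ

    private
      multiple-chain : ℕ → Fin n → ℤ
      multiple-chain k j = + k * δ σ j

      multiple-chain-supported : ∀ k → Supported Υ (multiple-chain k)
      multiple-chain-supported k j j∉Υ = trans (cong (+ k *_) (δ-supported σ∈Υ j j∉Υ)) (ℤ.*-zeroʳ (+ k))

      ∂multiple-chain : ∀ k i → (bd *ᵛ multiple-chain k) i ≡ multiple k i
      ∂multiple-chain k i = trans (*ᵛ-scale bd (+ k) (δ σ) i) (cong (+ k *_) (*ᵛ-δ bd σ i))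

    multiple-inSpan : ∀ k → InSpan bd Υ (multiple k)
    multiple-inSpan k = multiple-chain k , multiple-chain-supported k , ∂multiple-chain k

    σ-coordinate-multiple : ∀ k → σ-coordinate (multiple k) ≡ + k
    σ-coordinate-multiple k = begin
      σ-coordinate (multiple k)                ≡⟨ σ-coordinate-cong (λ i → sym (∂multiple-chain k i)) ⟩
      σ-coordinate (bd *ᵛ multiple-chain k)    ≡⟨ σ-coordinate-Υ (multiple-chain k) (multiple-chain-supported k) ⟩
      + k * δ σ σ                              ≡⟨ cong (+ k *_) (δ-diag σ) ⟩
      + k * 1ℤ                                 ≡⟨ ℤ.*-identityʳ (+ k) ⟩
      + k                                      ∎
      where open ≡-Reasoning

    -- With ∣q∣ = Q, the classes of k ∂σ for k < Q and the residues mod Q of σ-coordinates of torsion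
    -- cycles give injections both ways between Fin Q and the torsion classes of X.
    module TorsionCount (Q′ : ℕ) (∣q∣≡Q : ℤ.∣ q σ ρ ∣ ≡ suc Q′) {t} (order : HasTorsionOrder Σc X t) where

      private
        Q = suc Q′
        f = proj₁ order
        f-torsion = proj₁ (proj₂ order)
        f-distinct = proj₁ (proj₂ (proj₂ order))
        f-exhaustive = proj₂ (proj₂ (proj₂ order))

        q∣Q : q σ ρ ∣ + Q
        q∣Q = subst (λ k → q σ ρ ∣ + k) ∣q∣≡Q m∣∣m∣

        Q∣q : (+ Q) ∣ q σ ρ
        Q∣q = subst (λ k → (+ k) ∣ q σ ρ) ∣q∣≡Q ∣m∣∣m

      multiple-torsion : ∀ k → IsTorsionCycle Σc X (multiple k)
      multiple-torsion k = inSpan⇒cycle (multiple-inSpan k) , Q′ ,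
        InBoundaries-cong (λ i → ℤ.+-identityʳ (+ Q * multiple k i))
          (divisible⇒homologous (λ i → + Q * multiple k i) (λ _ → 0ℤ)
            (InSpan-cong {M = bd} (λ i → sym (trans (ℤ.+-identityʳ (+ Q * multiple k i)) (Qk≡ i))) (multiple-inSpan (Q ℕ.* k)))
            (subst (q σ ρ ∣_) (sym σ-coord≡Qk) (∣m⇒∣m*n (+ k) q∣Q)))
        where
        Qk≡ : ∀ i → + Q * multiple k i ≡ multiple (Q ℕ.* k) i
        Qk≡ i = trans (sym (ℤ.*-assoc (+ Q) (+ k) (bd i σ))) (cong (_* bd i σ) (sym (ℤ.pos-* Q k)))
        σ-coord≡Qk : σ-coordinate (λ i → + Q * multiple k i - 0ℤ) ≡ + Q * + k
        σ-coord≡Qk = begin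
          σ-coordinate (λ i → + Q * multiple k i - 0ℤ)  ≡⟨ σ-coordinate-cong (λ i → trans (ℤ.+-identityʳ (+ Q * multiple k i)) (Qk≡ i)) ⟩
          σ-coordinate (multiple (Q ℕ.* k))            ≡⟨ σ-coordinate-multiple (Q ℕ.* k) ⟩
          + (Q ℕ.* k)                                  ≡⟨ ℤ.pos-* Q k ⟩
          + Q * + k                                    ∎
          where open ≡-Reasoning

      class : Fin Q → Fin t
      class k = proj₁ (f-exhaustive (multiple (toℕ k)) (multiple-torsion (toℕ k)))

      class-injective : ∀ {a b} → class a ≡ class b → a ≡ b
      class-injective {a} {b} same = Fin.toℕ-injective (small-difference (Fin.toℕ<n a) (Fin.toℕ<n b) (∣-trans Q∣q q∣a-b))
        where
        in-class : ∀ k → HomologousIn Σc X (multiple (toℕ k)) (f (class k))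
        in-class k = proj₂ (f-exhaustive (multiple (toℕ k)) (multiple-torsion (toℕ k)))
        F = σ-coordinate (f (class a))
        q∣-F : ∀ (k : Fin Q) → HomologousIn Σc X (multiple (toℕ k)) (f (class a)) → q σ ρ ∣ (+ toℕ k - F)
        q∣-F k hom = subst (q σ ρ ∣_)
          (trans (σ-coordinate-sub (multiple (toℕ k)) (f (class a))) (cong (_- F) (σ-coordinate-multiple (toℕ k))))
          (homologous⇒divisible (multiple (toℕ k)) (f (class a)) hom)
        q∣a-b : q σ ρ ∣ (+ toℕ a - + toℕ b)
        q∣a-b = subst (q σ ρ ∣_) (cancel (+ toℕ a) (+ toℕ b) F)
          (∣m∣n⇒∣m-n (q∣-F a (in-class a)) (q∣-F b (subst (λ c → HomologousIn Σc X (multiple (toℕ b)) (f c)) (sym same) (in-class b))))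
          where
          cancel : ∀ a b F → (a - F) - (b - F) ≡ a - b
          cancel = solve-∀

      residue : Fin t → Fin Q
      residue c = fromℕ< (n%ℕd<d (σ-coordinate (f c)) Q)

      residue-injective : ∀ {c c′} → residue c ≡ residue c′ → c ≡ c′
      residue-injective {c} {c′} same with c ≟ c′
      ... | yes c≡c′ = c≡c′
      ... | no  c≢c′ = contradiction homologous (f-distinct c c′ c≢c′)
        where
        same-residue : σ-coordinate (f c) ℤ.%ℕ Q ≡ σ-coordinate (f c′) ℤ.%ℕ Q
        same-residue = trans (sym (Fin.toℕ-fromℕ< (n%ℕd<d (σ-coordinate (f c)) Q)))
                             (trans (cong toℕ same) (Fin.toℕ-fromℕ< (n%ℕd<d (σ-coordinate (f c′)) Q)))
        homologous : HomologousIn Σc X (f c) (f c′)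
        homologous = divisible⇒homologous (f c) (f c′)
          (InSpan-sub {M = bd} (torsion⇒inSpan (f c) (f-torsion c)) (torsion⇒inSpan (f c′) (f-torsion c′)))
          (subst (q σ ρ ∣_) (sym (σ-coordinate-sub (f c) (f c′)))
            (∣-trans q∣Q (same-residue⇒divisible (σ-coordinate (f c)) (σ-coordinate (f c′)) Q same-residue)))

      torsion-order : t ≡ ℤ.∣ q σ ρ ∣
      torsion-order = trans (ℕ.≤-antisym (Fin.injective⇒≤ residue-injective) (Fin.injective⇒≤ class-injective)) (sym ∣q∣≡Q)

    pair-ρ : ∀ φ → (∀ τ → τ ∈ Υ ─ ⁅ σ ⁆ → pair Σc φ τ ≡ 0ℚ) → pair Σc φ ρ ≡ toℚ (q σ ρ) ℚ.* pair Σc φ σ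
    pair-ρ φ φ-vanishes = begin
      pair Σc φ ρ                                                     ≡⟨ pair≡ᵛ* φ ρ ⟩
      ℚᴹ.sum (λ i → φ i ℚ.* toℚ (bd i ρ))                             ≡⟨ ℚᴹ.sum-cong-≋ (λ i → cong (φ i ℚ.*_) (column i)) ⟩
      ℚᴹ.sum (λ i → φ i ℚ.* (bdᵠ ℚᴹ.*ᵛ (toℚ ∘ coordinates ρ)) i)      ≡⟨ ℚᴹ.ᵛ*-*ᵛ bdᵠ φ (toℚ ∘ coordinates ρ) ⟩
      ℚᴹ.sum (λ τ → (φ ℚᴹ.ᵛ* bdᵠ) τ ℚ.* toℚ (coordinates ρ τ))        ≡⟨ ℚᴹ.sum-single (λ τ → (φ ℚᴹ.ᵛ* bdᵠ) τ ℚ.* toℚ (coordinates ρ τ)) σ off-σ ⟩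
      (φ ℚᴹ.ᵛ* bdᵠ) σ ℚ.* toℚ (coordinates ρ σ)                       ≡⟨ cong₂ ℚ._*_ (sym (pair≡ᵛ* φ σ)) (cong toℚ (restrict-∈ (λ τ → q τ ρ) σ∈Υ)) ⟩
      pair Σc φ σ ℚ.* toℚ (q σ ρ)                                     ≡⟨ ℚ.*-comm (pair Σc φ σ) (toℚ (q σ ρ)) ⟩
      toℚ (q σ ρ) ℚ.* pair Σc φ σ                                     ∎
      where
      open ≡-Reasoning
      column : ∀ i → toℚ (bd i ρ) ≡ (bdᵠ ℚᴹ.*ᵛ (toℚ ∘ coordinates ρ)) i
      column i = sym (trans (*ᵛ-toℚ (coordinates ρ) i) (cong toℚ (expansion ρ i)))
      off-σ : ∀ τ → τ ≢ σ → (φ ℚᴹ.ᵛ* bdᵠ) τ ℚ.* toℚ (coordinates ρ τ) ≡ 0ℚ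
      off-σ τ τ≢σ with τ ∈? Υ
      ... | yes τ∈Υ = trans (cong (ℚ._* toℚ (coordinates ρ τ)) (trans (sym (pair≡ᵛ* φ τ)) (φ-vanishes τ (x∈p∧x≢y⇒x∈p-y τ∈Υ τ≢σ))))
                            (ℚ.*-zeroˡ (toℚ (coordinates ρ τ)))
      ... | no  τ∉Υ = trans (cong (λ t → (φ ℚᴹ.ᵛ* bdᵠ) τ ℚ.* toℚ t) (restrict-∉ (λ τ → q τ ρ) τ∉Υ)) (ℚ.*-zeroʳ ((φ ℚᴹ.ᵛ* bdᵠ) τ))

    sign-of-q : ∀ e → IsSign Σc (Υ ─ ⁅ σ ⁆) σ ρ e → q σ ρ ≡ e * + ℤ.∣ q σ ρ ∣
    sign-of-q e (inj₁ (refl , φ , φ-vanishes , 0<φσ , 0<φρ)) =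
      toℚ-positive (q σ ρ) (factor-positive 0<φσ (subst (0ℚ ℚ.<_) (pair-ρ φ φ-vanishes) 0<φρ))
    sign-of-q e (inj₂ (refl , φ , φ-vanishes , 0<φσ , φρ<0)) =
      toℚ-negative (q σ ρ) (factor-negative 0<φσ (subst (ℚ._< 0ℚ) (pair-ρ φ φ-vanishes) φρ<0))

    private
      circuitᵠ : Fin n → ℚ
      circuitᵠ = toℚ ∘ circuit

      ∂circuitᵠ≡0 : ∀ i → (bdᵠ ℚᴹ.*ᵛ circuitᵠ) i ≡ 0ℚ
      ∂circuitᵠ≡0 i = trans (*ᵛ-toℚ circuit i) (cong toℚ (∂circuit≡0 i))

      ∂-add-circuitᵠ : ∀ c t i → bdℚ Σc (λ j → c j ℚ.+ t ℚ.* circuitᵠ j) i ≡ bdℚ Σc c i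
      ∂-add-circuitᵠ c t i = trans (bdℚ≡*ᵛ (λ j → c j ℚ.+ t ℚ.* circuitᵠ j) i)
                                   (trans (ℚᴹ.*ᵛ-add-kernel bdᵠ ∂circuitᵠ≡0 c t i) (sym (bdℚ≡*ᵛ c i)))

      σ∉X : ρ ∉ Υ → σ ∉ X
      σ∉X ρ∉Υ σ∈X with ∈-exchange⁻ σ∈X
      ... | inj₁ (_ , σ≢σ) = σ≢σ refl
      ... | inj₂ σ≡ρ       = ρ∉Υ (subst (_∈ Υ) σ≡ρ σ∈Υ)

      ρ≢σ : ρ ∉ Υ → ρ ≢ σ
      ρ≢σ ρ∉Υ ρ≡σ = ρ∉Υ (subst (_∈ Υ) (sym ρ≡σ) σ∈Υ)

    exchange-independent⇒q≢0 : ρ ∉ Υ → LinIndep Σc X → q σ ρ ≢ 0ℤ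
    exchange-independent⇒q≢0 ρ∉Υ indep q≡0 with trans (sym (circuit-ρ ρ∉Υ)) (toℚ-injective {b = 0ℤ} (indep circuitᵠ supported ∂≡0 ρ))
      where
      supported : SupportedOnℚ Σc X circuitᵠ
      supported j j∉X with j ∈? Υ
      ... | no  j∉Υ = cong toℚ (circuit-off j∉Υ (∉X⇒≢ρ j∉X))
      ... | yes j∈Υ with j ≟ σ
      ...   | yes refl = cong toℚ (trans (circuit-σ (ρ≢σ ρ∉Υ)) q≡0)
      ...   | no  j≢σ  = contradiction (∈Υ∖σ⇒∈X j∈Υ j≢σ) j∉X
      ∂≡0 : ∀ i → bdℚ Σc circuitᵠ i ≡ 0ℚ
      ∂≡0 i = trans (bdℚ≡*ᵛ circuitᵠ i) (∂circuitᵠ≡0 i)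
    ... | ()

    -- Adding (c ρ)·circuit moves a relation c over X onto Υ, where it must vanish; its σ-entry is then
    -- (c ρ)·q σ ρ, so c ρ = 0 and c = 0. Dually, subtracting (c′ σ / q σ ρ)·circuit clears σ.
    exchange-linIndep : ρ ∉ Υ → q σ ρ ≢ 0ℤ → LinIndep Σc X
    exchange-linIndep ρ∉Υ q≢0 c c∈X ∂c≡0 j = begin
      c j                                   ≡⟨ ℚ.+-identityʳ (c j) ⟨
      c j ℚ.+ 0ℚ                            ≡⟨ cong (c j ℚ.+_) (ℚ.*-zeroˡ (circuitᵠ j)) ⟨
      c j ℚ.+ 0ℚ ℚ.* circuitᵠ j             ≡⟨ cong (λ t → c j ℚ.+ t ℚ.* circuitᵠ j) cρ≡0 ⟨
      c″ j                                  ≡⟨ c″≡0 j ⟩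
      0ℚ                                    ∎
      where
      open ≡-Reasoning
      c″ : Fin n → ℚ
      c″ k = c k ℚ.+ c ρ ℚ.* circuitᵠ k
      c″∈Υ : SupportedOnℚ Σc Υ c″
      c″∈Υ k k∉Υ with k ≟ ρ
      ... | yes refl = begin
        c ρ ℚ.+ c ρ ℚ.* circuitᵠ ρ        ≡⟨ cong (λ t → c ρ ℚ.+ c ρ ℚ.* toℚ t) (circuit-ρ ρ∉Υ) ⟩
        c ρ ℚ.+ c ρ ℚ.* ℚ.- 1ℚ            ≡⟨ cong (c ρ ℚ.+_) (ℚ.neg-distribʳ-* (c ρ) 1ℚ) ⟨
        c ρ ℚ.+ ℚ.- (c ρ ℚ.* 1ℚ)          ≡⟨ cong (λ t → c ρ ℚ.+ ℚ.- t) (ℚ.*-identityʳ (c ρ)) ⟩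
        c ρ ℚ.+ ℚ.- c ρ                   ≡⟨ ℚ.+-inverseʳ (c ρ) ⟩
        0ℚ                                ∎
      ... | no  k≢ρ  = begin
        c k ℚ.+ c ρ ℚ.* circuitᵠ k        ≡⟨ cong₂ (λ s t → s ℚ.+ c ρ ℚ.* toℚ t) (c∈X k k∉X) (circuit-off k∉Υ k≢ρ) ⟩
        0ℚ ℚ.+ c ρ ℚ.* 0ℚ                 ≡⟨ cong (0ℚ ℚ.+_) (ℚ.*-zeroʳ (c ρ)) ⟩
        0ℚ                                ∎
        where
        k∉X : k ∉ X
        k∉X k∈X with ∈-exchange⁻ k∈X
        ... | inj₁ (k∈Υ , _) = k∉Υ k∈Υ
        ... | inj₂ k≡ρ       = k≢ρ k≡ρ
      c″≡0 : ∀ k → c″ k ≡ 0ℚ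
      c″≡0 = proj₁ csf c″ c″∈Υ (λ i → trans (∂-add-circuitᵠ c (c ρ) i) (∂c≡0 i))
      cρ≡0 : c ρ ≡ 0ℚ
      cρ≡0 = toℚ-cancelʳ (c ρ) (q σ ρ) q≢0 (begin
        c ρ ℚ.* toℚ (q σ ρ)               ≡⟨ cong (λ t → c ρ ℚ.* toℚ t) (circuit-σ (ρ≢σ ρ∉Υ)) ⟨
        c ρ ℚ.* circuitᵠ σ                ≡⟨ ℚ.+-identityˡ (c ρ ℚ.* circuitᵠ σ) ⟨
        0ℚ ℚ.+ c ρ ℚ.* circuitᵠ σ         ≡⟨ cong (ℚ._+ c ρ ℚ.* circuitᵠ σ) (c∈X σ (σ∉X ρ∉Υ)) ⟨
        c″ σ                              ≡⟨ c″≡0 σ ⟩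
        0ℚ                                ∎)

    exchange-spans : ρ ∉ Υ → q σ ρ ≢ 0ℤ → SpansColSpace Σc X
    exchange-spans ρ∉Υ q≢0 c = c‴ , supported , λ i → trans (∂-add-circuitᵠ c′ (ℚ.- α) i) (∂c′≡∂c i)
      where
      spanned = proj₂ csf c
      c′ = proj₁ spanned
      c′∈Υ = proj₁ (proj₂ spanned)
      ∂c′≡∂c = proj₂ (proj₂ spanned)
      r = proj₁ (toℚ-invertible (q σ ρ) q≢0)
      qr≡1 = proj₂ (toℚ-invertible (q σ ρ) q≢0)
      α = c′ σ ℚ.* r
      c‴ : Fin n → ℚ
      c‴ j = c′ j ℚ.+ ℚ.- α ℚ.* circuitᵠ j
      supported : SupportedOnℚ Σc X c‴
      supported j j∉X with j ∈? Υ
      ... | no  j∉Υ = begin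
        c′ j ℚ.+ ℚ.- α ℚ.* circuitᵠ j     ≡⟨ cong₂ (λ s t → s ℚ.+ ℚ.- α ℚ.* toℚ t) (c′∈Υ j j∉Υ) (circuit-off j∉Υ (∉X⇒≢ρ j∉X)) ⟩
        0ℚ ℚ.+ ℚ.- α ℚ.* 0ℚ               ≡⟨ cong (0ℚ ℚ.+_) (ℚ.*-zeroʳ (ℚ.- α)) ⟩
        0ℚ                                ∎
        where open ≡-Reasoning
      ... | yes j∈Υ with j ≟ σ
      ...   | no  j≢σ  = contradiction (∈Υ∖σ⇒∈X j∈Υ j≢σ) j∉X
      ...   | yes refl = begin
        c′ σ ℚ.+ ℚ.- α ℚ.* circuitᵠ σ     ≡⟨ cong (λ t → c′ σ ℚ.+ ℚ.- α ℚ.* toℚ t) (circuit-σ (ρ≢σ ρ∉Υ)) ⟩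
        c′ σ ℚ.+ ℚ.- α ℚ.* toℚ (q σ ρ)    ≡⟨ cong (c′ σ ℚ.+_) (ℚ.neg-distribˡ-* α (toℚ (q σ ρ))) ⟨
        c′ σ ℚ.+ ℚ.- (α ℚ.* toℚ (q σ ρ))  ≡⟨ cong (λ t → c′ σ ℚ.+ ℚ.- t) α·q≡c′σ ⟩
        c′ σ ℚ.+ ℚ.- c′ σ                 ≡⟨ ℚ.+-inverseʳ (c′ σ) ⟩
        0ℚ                                ∎
        where
        open ≡-Reasoning
        α·q≡c′σ : α ℚ.* toℚ (q σ ρ) ≡ c′ σ
        α·q≡c′σ = begin
          c′ σ ℚ.* r ℚ.* toℚ (q σ ρ)      ≡⟨ ℚ.*-assoc (c′ σ) r (toℚ (q σ ρ)) ⟩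
          c′ σ ℚ.* (r ℚ.* toℚ (q σ ρ))    ≡⟨ cong (c′ σ ℚ.*_) (trans (ℚ.*-comm r (toℚ (q σ ρ))) qr≡1) ⟩
          c′ σ ℚ.* 1ℚ                     ≡⟨ ℚ.*-identityʳ (c′ σ) ⟩
          c′ σ                            ∎

    q≢0⇒exchange-CSF : ρ ∉ Υ → q σ ρ ≢ 0ℤ → IsCSF Σc X
    q≢0⇒exchange-CSF ρ∉Υ q≢0 = exchange-linIndep ρ∉Υ q≢0 , exchange-spans ρ∉Υ q≢0

  module _ (Σc : CellComplex) (Υ : Subset (CellComplex.n Σc)) (B : Fin (CellComplex.n Σc) → Subset (CellComplex.n Σc))
           (eps : Fin (CellComplex.n Σc) → Fin (CellComplex.n Σc) → ℤ) (T : Subset (CellComplex.n Σc) → ℕ) where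

    chi-∈ : ∀ {σ ρ} → ρ ∈ B σ → chi Σc Υ B eps T σ ρ ≡ eps σ ρ * + T ((Υ ─ ⁅ σ ⁆) ∪ ⁅ ρ ⁆)
    chi-∈ {σ} {ρ} ρ∈B with Vec.lookup (B σ) ρ in eq
    ... | true  = refl
    ... | false = contradiction (trans (sym ([]=⇒lookup ρ∈B)) eq) λ ()

    chi-∉ : ∀ {σ ρ} → ρ ∉ B σ → chi Σc Υ B eps T σ ρ ≡ 0ℤ
    chi-∉ {σ} {ρ} ρ∉B with Vec.lookup (B σ) ρ in eq
    ... | true  = contradiction (lookup⇒[]= ρ (B σ) eq) ρ∉B
    ... | false = refl

  module _ (Σc : CellComplex) (Υ : Subset (CellComplex.n Σc)) (csf : IsCSF Σc Υ) (tf : TorsionFree Σc Υ)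
           (σ : Fin (CellComplex.n Σc)) (σ∈Υ : σ ∈ Υ) (ρ : Fin (CellComplex.n Σc)) where

    open CellComplex Σc
    open Chains Σc
    open Coordinates Σc Υ csf tf
    open Exchange Σc Υ csf tf σ σ∈Υ ρ

    in-bond⇒CSF : InBond Σc Υ σ ρ → IsCSF Σc X
    in-bond⇒CSF (inj₂ (_ , X-csf)) = X-csf
    in-bond⇒CSF (inj₁ refl)        = IsCSF-cong Υ⊆X X⊆Υ csf
      where
      Υ⊆X : ∀ {j} → j ∈ Υ → j ∈ X
      Υ⊆X {j} j∈Υ with j ≟ σ
      ... | yes j≡σ = ∈-exchange⁺ (inj₂ j≡σ)
      ... | no  j≢σ = ∈-exchange⁺ (inj₁ (j∈Υ , j≢σ))
      X⊆Υ : ∀ {j} → j ∈ X → j ∈ Υ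
      X⊆Υ j∈X with ∈-exchange⁻ j∈X
      ... | inj₁ (j∈Υ , _) = j∈Υ
      ... | inj₂ refl      = σ∈Υ

    in-bond⇒q≢0 : InBond Σc Υ σ ρ → q σ ρ ≢ 0ℤ
    in-bond⇒q≢0 (inj₁ refl)             q≡0 = contradiction (trans (sym (δ-diag σ)) (trans (sym (y-dual σ σ σ∈Υ σ∈Υ)) q≡0)) λ ()
    in-bond⇒q≢0 (inj₂ (ρ∉Υ , X-csf))    = exchange-independent⇒q≢0 ρ∉Υ (proj₁ X-csf)

    q≢0⇒in-bond : q σ ρ ≢ 0ℤ → InBond Σc Υ σ ρ
    q≢0⇒in-bond q≢0 with ρ ∈? Υ
    ... | no  ρ∉Υ = inj₂ (ρ∉Υ , q≢0⇒exchange-CSF ρ∉Υ q≢0)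
    ... | yes ρ∈Υ with ρ ≟ σ
    ...   | yes ρ≡σ = inj₁ ρ≡σ
    ...   | no  ρ≢σ = contradiction (trans (y-dual σ ρ σ∈Υ ρ∈Υ) (δ-off (ρ≢σ ∘ sym))) q≢0

    torsion-order-in-bond : ∀ {t} → InBond Σc Υ σ ρ → HasTorsionOrder Σc X t → t ≡ ℤ.∣ q σ ρ ∣
    torsion-order-in-bond {t} in-bond order with ℤ.∣ q σ ρ ∣ in ∣q∣≡
    ... | 0     = contradiction (ℤ.∣i∣≡0⇒i≡0 ∣q∣≡) (in-bond⇒q≢0 in-bond)
    ... | suc Q′ = trans (TorsionCount.torsion-order Q′ ∣q∣≡ order) ∣q∣≡

    chi≡q : ∀ B eps T → (∀ X → IsCSF Σc X → HasTorsionOrder Σc X (T X)) →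
            (ρ ∈ B σ → InBond Σc Υ σ ρ) → (InBond Σc Υ σ ρ → ρ ∈ B σ) →
            (InBond Σc Υ σ ρ → IsSign Σc (Υ ─ ⁅ σ ⁆) σ ρ (eps σ ρ)) →
            chi Σc Υ B eps T σ ρ ≡ q σ ρ
    chi≡q B eps T torsion-orders bond⇒in-bond in-bond⇒bond signs with ρ ∈? B σ
    ... | yes ρ∈B = begin
      chi Σc Υ B eps T σ ρ          ≡⟨ chi-∈ Σc Υ B eps T ρ∈B ⟩
      eps σ ρ * + T X               ≡⟨ cong (λ t → eps σ ρ * + t) (torsion-order-in-bond in-bond (torsion-orders X (in-bond⇒CSF in-bond))) ⟩
      eps σ ρ * + ℤ.∣ q σ ρ ∣       ≡⟨ sign-of-q (eps σ ρ) (signs in-bond) ⟨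
      q σ ρ                         ∎
      where
      open ≡-Reasoning
      in-bond = bond⇒in-bond ρ∈B
    ... | no  ρ∉B with q σ ρ ℤ.≟ 0ℤ
    ...   | yes q≡0 = trans (chi-∉ Σc Υ B eps T ρ∉B) (sym q≡0)
    ...   | no  q≢0 = contradiction (in-bond⇒bond (q≢0⇒in-bond q≢0)) ρ∉B

open SpanningForests using (module Coordinates; chi≡q)
-- Imported last: inside the modules above, _-_ is integer subtraction.
open import Data.Fin.Subset using (_-_)

theorem6p1 : (Σc : CellComplex) → (Υ : Subset (CellComplex.n Σc))
  → IsCSF Σc Υ
  → TorsionFree Σc Υ
  → (T : Subset (CellComplex.n Σc) → ℕ)
  → (∀ X → IsCSF Σc X → HasTorsionOrder Σc X (T X))
  → (B : Fin (CellComplex.n Σc) → Subset (CellComplex.n Σc))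
  → (∀ σ → σ ∈ Υ → ∀ ρ → (ρ ∈ B σ → InBond Σc Υ σ ρ) × (InBond Σc Υ σ ρ → ρ ∈ B σ))
  → (eps : Fin (CellComplex.n Σc) → Fin (CellComplex.n Σc) → ℤ)
  → (∀ σ → σ ∈ Υ → ∀ ρ → InBond Σc Υ σ ρ → IsSign Σc (Υ - σ) σ ρ (eps σ ρ))
  → IsCutLatticeBasis Σc Υ (chi Σc Υ B eps T)
theorem6p1 Σc Υ csf tf T hT B hB eps hE =
  Coordinates.cut-lattice-basis Σc Υ csf tf (chi Σc Υ B eps T) λ σ σ∈Υ ρ →
    chi≡q Σc Υ csf tf σ σ∈Υ ρ B eps T hT (proj₁ (hB σ σ∈Υ ρ)) (proj₂ (hB σ σ∈Υ ρ)) (hE σ σ∈Υ ρ)
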